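{- Let $n\ge 1$ and let $L_n$ be the ladder graph with vertices $p_1,\dots,p_n,q_1,\dots,q_n$, regarded as an electrical network with unit resistance on each edge, and let $r(\cdot,\cdot)$ denote effective resistance in $L_n$. Put $\alpha=2-\sqrt{3}$. Then for all integers $i,j$ with $n\ge i\ge j\ge 1$, $$r(p_i,p_j)=\frac{i-j}{2}+\frac{1-\alpha^{i-j}}{4\sqrt3\,(1-\alpha^{2n})}\Bigl(2-\alpha^{i+j-1}+\alpha^{2j-1}+\alpha^{2n-2i+1}\bigl(1-\alpha^{i-j}-2\alpha^{i+j-1}\bigr)\Bigr),$$ $$r(q_i,p_j)=\frac{i-j}{2}+\frac{1+\alpha^{i-j}}{4\sqrt3\,(1-\alpha^{2n})}\Bigl(2+\alpha^{i+j-1}+\alpha^{2j-1}+\alpha^{2n-2i+1}\bigl(1+\alpha^{i-j}+2\alpha^{i+j-1}\bigr)\Bigr).$$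
   Context: The ladder graph $L_n$ ($n\ge1$) has $2n$ vertices $p_1,\dots,p_n,q_1,\dots,q_n$ and $3n-2$ edges: $\{p_i,p_{i+1}\}$ and $\{q_i,q_{i+1}\}$ for $1\le i\le n-1$, and $\{p_i,q_i\}$ for $1\le i\le n$. Each edge has length (resistance) $1$. The effective resistance $r(p,q)$ is the resistance between $p$ and $q$ in this network (with $r(p,p)=0$). -}

module Defs where

open import Data.Bool using (Bool; true; false; if_then_else_; _∧_)
open import Data.Nat as ℕ using (ℕ; zero; suc; _∸_; _≤ᵇ_; _<ᵇ_; _≡ᵇ_)
open import Data.Integer using (+_; -[1+_])
open import Data.Rational using (ℚ; _/_; 0ℚ; 1ℚ) renaming (_+_ to _+ℚ_; _*_ to _*ℚ_; _-_ to _-ℚ_)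
open import Data.Product using (Σ; _×_; _,_)
open import Relation.Binary.PropositionalEquality using (_≡_)

-- The ladder graph L_n.
-- Vertices: (P , k) = p_k and (Q , k) = q_k for 1 ≤ k ≤ n.
-- Indices outside 1..n are simply never constrained / used.

data Side : Set where
  P Q : Side

other : Side → Side
other P = Q
other Q = P

sideEq : Side → Side → Bool
sideEq P P = true
sideEq Q Q = true
sideEq _ _ = false

Vertex : Set
Vertex = Side × ℕ

Potential : Set
Potential = Side → ℕ → ℚ

laplacian : ℕ → Potential → Side → ℕ → ℚ
laplacian n v s k =
  (v s k -ℚ v (other s) k)
  +ℚ (if 2 ≤ᵇ k then v s k -ℚ v s (k ∸ 1) else 0ℚ)
  +ℚ (if k <ᵇ n then v s k -ℚ v s (suc k) else 0ℚ)

ind : Vertex → Side → ℕ → ℚ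
ind (s , k) s' k' = if sideEq s s' ∧ (k ≡ᵇ k') then 1ℚ else 0ℚ

-- v is a potential for unit current entering at a and leaving at b
-- (Kirchhoff's current law at every vertex of L_n).
UnitFlowPotential : ℕ → Vertex → Vertex → Potential → Set
UnitFlowPotential n a b v =
  (s : Side) (k : ℕ) → 1 ℕ.≤ k → k ℕ.≤ n →
  laplacian n v s k ≡ ind a s k -ℚ ind b s k

pot : Potential → Vertex → ℚ
pot v (s , k) = v s k

IsEffectiveResistance : ℕ → Vertex → Vertex → ℚ → Set
IsEffectiveResistance n a b r =
  Σ Potential (UnitFlowPotential n a b)
  × ((v : Potential) → UnitFlowPotential n a b v → pot v a -ℚ pot v b ≡ r)

-- The field ℚ(√3): x = re + im·√3, with re, im ∈ ℚ (unique representation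
-- since √3 is irrational).

record Q3 : Set where
  constructor mkQ3
  field
    re : ℚ
    im : ℚ

open Q3 public

infixl 6 _⊕_ _⊖_
infixl 7 _⊗_

_⊕_ : Q3 → Q3 → Q3
mkQ3 a b ⊕ mkQ3 c d = mkQ3 (a +ℚ c) (b +ℚ d)

_⊖_ : Q3 → Q3 → Q3
mkQ3 a b ⊖ mkQ3 c d = mkQ3 (a -ℚ c) (b -ℚ d)

_⊗_ : Q3 → Q3 → Q3
mkQ3 a b ⊗ mkQ3 c d =
  mkQ3 (a *ℚ c +ℚ (+ 3 / 1) *ℚ (b *ℚ d)) (a *ℚ d +ℚ b *ℚ c)

emb : ℚ → Q3
emb a = mkQ3 a 0ℚ

nat : ℕ → Q3
nat m = emb (+ m / 1)

one : Q3
one = nat 1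

sqrt3 : Q3
sqrt3 = mkQ3 0ℚ 1ℚ

_^_ : Q3 → ℕ → Q3
x ^ zero = one
x ^ suc m = x ⊗ (x ^ m)

α : Q3
α = mkQ3 (+ 2 / 1) (-[1+ 0 ] / 1)

halfDiff : ℕ → ℕ → ℚ
halfDiff i j = + (i ∸ j) / 2

module Submission where

-- Write a potential as v(p_k) = U k + W k and v(q_k) = U k - W k.  Once v is extended to k = 0 and
-- k = n + 1 by reflection (Neumann conditions), Kirchhoff's law at p_k and q_k decouples into two
-- problems on the path 1..n:  2 U k - U (k-1) - U (k+1) = (δ_ik - δ_jk)/2, and the same with 4 W k
-- in place of 2 U k (the rung adds 2 W k) and right-hand side ±δ_ik/2 ∓ δ_jk/2.  The first is solved
-- by U k = (min(k,i) - min(k,j))/2, the second by the Green's function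
-- A(min(k,l)) A(n+1-max(k,l)) / (A(n+1) - A n), where A 0 = A 1 = 1 and A(k+2) = 4 A(k+1) - A k.
-- The difference of two flow potentials is harmonic; by the same recurrences its U-part is constant
-- and its W-part is A k W 1 with (A(n+1) - A n) W 1 = 0, so v(a) - v(b) is the effective resistance.
-- Binet's formula 6 α^k A k = (3 - √3) + (3 + √3) α^(2k) then turns this rational value into the
-- stated closed form: after multiplying by 36 α^(n+1) both sides are polynomials in α^(j-1),
-- α^(i-j) and α^(n-i) over ℚ(√3).

open import Defs
open import Data.Nat using (ℕ; _≤_; _+_; _*_; _∸_)
open import Data.Nat using (zero; suc; _<_; _⊓_; _⊔_; _≤ᵇ_; _<ᵇ_; _≡ᵇ_; z≤n; s≤s)
import Data.Nat.Properties as ℕ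
open import Data.Bool using (true; false; if_then_else_; T)
open import Data.Integer as ℤ using (+_; -[1+_])
import Data.Integer.Properties as ℤ
open import Data.Rational using (ℚ; 0ℚ; 1ℚ; ½; _/_; 1/_; -_; NonZero; >-nonZero; toℚᵘ)
  renaming (_+_ to _+ℚ_; _-_ to _-ℚ_; _*_ to _*ℚ_; _≤_ to _≤ℚ_; _<_ to _<ℚ_)
import Data.Rational.Properties as ℚ
open import Data.Rational.Unnormalised as ℚᵘ using (mkℚᵘ; *≡*)
import Data.Rational.Unnormalised.Properties as ℚᵘ
open import Data.Rational.Solver using () renaming (module +-*-Solver to ℚ-Solver)
open import Data.Product using (Σ; _×_; _,_; proj₁; proj₂)
open import Data.Sum using (inj₁; inj₂)
open import Algebra.Structures using (IsCommutativeMonoid)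
open import Algebra.Structures.Biased using (isCommutativeSemiringˡ)
open import Algebra.Solver.Ring.AlmostCommutativeRing using (AlmostCommutativeRing)
import Algebra.Solver.Ring.Simple as RingSolver
open import Relation.Binary.Definitions using (DecidableEquality; tri<; tri≈; tri>)
open import Relation.Binary.PropositionalEquality
open import Relation.Nullary using (yes; no)
open import Relation.Nullary.Decidable using (dec-true; dec-false)

-- ℚ(√3) as a commutative ring

neg : Q3 → Q3
neg (mkQ3 a b) = mkQ3 (- a) (- b)

⊕-assoc : ∀ x y z → (x ⊕ y) ⊕ z ≡ x ⊕ (y ⊕ z)
⊕-assoc (mkQ3 a b) (mkQ3 c d) (mkQ3 e f) = cong₂ mkQ3 (ℚ.+-assoc a c e) (ℚ.+-assoc b d f)

⊕-comm : ∀ x y → x ⊕ y ≡ y ⊕ x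
⊕-comm (mkQ3 a b) (mkQ3 c d) = cong₂ mkQ3 (ℚ.+-comm a c) (ℚ.+-comm b d)

⊕-identityˡ : ∀ x → nat 0 ⊕ x ≡ x
⊕-identityˡ (mkQ3 a b) = cong₂ mkQ3 (ℚ.+-identityˡ a) (ℚ.+-identityˡ b)

⊕-identityʳ : ∀ x → x ⊕ nat 0 ≡ x
⊕-identityʳ (mkQ3 a b) = cong₂ mkQ3 (ℚ.+-identityʳ a) (ℚ.+-identityʳ b)

⊗-assoc : ∀ x y z → (x ⊗ y) ⊗ z ≡ x ⊗ (y ⊗ z)
⊗-assoc (mkQ3 a b) (mkQ3 c d) (mkQ3 e f) = cong₂ mkQ3
  (solve 6 (λ a b c d e f → (a :* c :+ con (+ 3 / 1) :* (b :* d)) :* e :+ con (+ 3 / 1) :* ((a :* d :+ b :* c) :* f)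
                         := a :* (c :* e :+ con (+ 3 / 1) :* (d :* f)) :+ con (+ 3 / 1) :* (b :* (c :* f :+ d :* e))) refl a b c d e f)
  (solve 6 (λ a b c d e f → (a :* c :+ con (+ 3 / 1) :* (b :* d)) :* f :+ (a :* d :+ b :* c) :* e
                         := a :* (c :* f :+ d :* e) :+ b :* (c :* e :+ con (+ 3 / 1) :* (d :* f))) refl a b c d e f)
  where open ℚ-Solver

⊗-comm : ∀ x y → x ⊗ y ≡ y ⊗ x
⊗-comm (mkQ3 a b) (mkQ3 c d) = cong₂ mkQ3
  (cong₂ _+ℚ_ (ℚ.*-comm a c) (cong (+ 3 / 1 *ℚ_) (ℚ.*-comm b d)))
  (trans (ℚ.+-comm (a *ℚ d) (b *ℚ c)) (cong₂ _+ℚ_ (ℚ.*-comm b c) (ℚ.*-comm a d)))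

⊗-identityˡ : ∀ x → one ⊗ x ≡ x
⊗-identityˡ (mkQ3 a b) = cong₂ mkQ3
  (solve 2 (λ a b → con 1ℚ :* a :+ con (+ 3 / 1) :* (con 0ℚ :* b) := a) refl a b)
  (solve 2 (λ a b → con 1ℚ :* b :+ con 0ℚ :* a := b) refl a b)
  where open ℚ-Solver

⊗-identityʳ : ∀ x → x ⊗ one ≡ x
⊗-identityʳ x = trans (⊗-comm x one) (⊗-identityˡ x)

⊗-distribʳ-⊕ : ∀ x y z → (y ⊕ z) ⊗ x ≡ (y ⊗ x) ⊕ (z ⊗ x)
⊗-distribʳ-⊕ (mkQ3 a b) (mkQ3 c d) (mkQ3 e f) = cong₂ mkQ3
  (solve 6 (λ a b c d e f → (c :+ e) :* a :+ con (+ 3 / 1) :* ((d :+ f) :* b)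
                         := (c :* a :+ con (+ 3 / 1) :* (d :* b)) :+ (e :* a :+ con (+ 3 / 1) :* (f :* b))) refl a b c d e f)
  (solve 6 (λ a b c d e f → (c :+ e) :* b :+ (d :+ f) :* a := (c :* b :+ d :* a) :+ (e :* b :+ f :* a)) refl a b c d e f)
  where open ℚ-Solver

⊗-zeroˡ : ∀ x → nat 0 ⊗ x ≡ nat 0
⊗-zeroˡ (mkQ3 a b) = cong₂ mkQ3
  (solve 2 (λ a b → con 0ℚ :* a :+ con (+ 3 / 1) :* (con 0ℚ :* b) := con 0ℚ) refl a b)
  (solve 2 (λ a b → con 0ℚ :* b :+ con 0ℚ :* a := con 0ℚ) refl a b)
  where open ℚ-Solver

neg-distribˡ-⊗ : ∀ x y → neg x ⊗ y ≡ neg (x ⊗ y)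
neg-distribˡ-⊗ (mkQ3 a b) (mkQ3 c d) = cong₂ mkQ3
  (solve 4 (λ a b c d → (:- a) :* c :+ con (+ 3 / 1) :* ((:- b) :* d) := :- (a :* c :+ con (+ 3 / 1) :* (b :* d))) refl a b c d)
  (solve 4 (λ a b c d → (:- a) :* d :+ (:- b) :* c := :- (a :* d :+ b :* c)) refl a b c d)
  where open ℚ-Solver

neg-distrib-⊕ : ∀ x y → neg x ⊕ neg y ≡ neg (x ⊕ y)
neg-distrib-⊕ (mkQ3 a b) (mkQ3 c d) = cong₂ mkQ3 (sym (ℚ.neg-distrib-+ a c)) (sym (ℚ.neg-distrib-+ b d))

_≟_ : DecidableEquality Q3
mkQ3 a b ≟ mkQ3 c d with a ℚ.≟ c | b ℚ.≟ d
... | yes refl | yes refl = yes refl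
... | no a≢c   | _        = no λ { refl → a≢c refl }
... | _        | no b≢d   = no λ { refl → b≢d refl }

Q3-almostCommutativeRing : AlmostCommutativeRing _ _
Q3-almostCommutativeRing = record
  { Carrier = Q3 ; _≈_ = _≡_ ; _+_ = _⊕_ ; _*_ = _⊗_ ; -_ = neg ; 0# = nat 0 ; 1# = one
  ; isAlmostCommutativeRing = record
    { isCommutativeSemiring = isCommutativeSemiringˡ record
      { +-isCommutativeMonoid = isCommutativeMonoid _⊕_ ⊕-assoc ⊕-comm ⊕-identityˡ ⊕-identityʳ
      ; *-isCommutativeMonoid = isCommutativeMonoid _⊗_ ⊗-assoc ⊗-comm ⊗-identityˡ ⊗-identityʳ
      ; distribʳ = ⊗-distribʳ-⊕
      ; zeroˡ = ⊗-zeroˡ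
      }
    ; -‿cong = cong neg
    ; -‿*-distribˡ = neg-distribˡ-⊗
    ; -‿+-comm = neg-distrib-⊕
    }
  }
  where
  isCommutativeMonoid : ∀ _∙_ {e} → (∀ x y z → (x ∙ y) ∙ z ≡ x ∙ (y ∙ z)) → (∀ x y → x ∙ y ≡ y ∙ x) →
                        (∀ x → e ∙ x ≡ x) → (∀ x → x ∙ e ≡ x) → IsCommutativeMonoid _≡_ _∙_ e
  isCommutativeMonoid _∙_ assoc comm idˡ idʳ = record
    { isMonoid = record
      { isSemigroup = record { isMagma = record { isEquivalence = isEquivalence ; ∙-cong = cong₂ _∙_ } ; assoc = assoc }
      ; identity = idˡ , idʳ }
    ; comm = comm }

module Q3-Solver = RingSolver Q3-almostCommutativeRing _≟_

emb-* : ∀ a b → emb (a *ℚ b) ≡ emb a ⊗ emb b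
emb-* a b = cong₂ mkQ3
  (sym (trans (cong (a *ℚ b +ℚ_) (ℚ.*-zeroʳ (+ 3 / 1))) (ℚ.+-identityʳ (a *ℚ b))))
  (sym (trans (cong₂ _+ℚ_ (ℚ.*-zeroʳ a) (ℚ.*-zeroˡ b)) (ℚ.+-identityˡ 0ℚ)))

⊗-cancelʳ : ∀ {x y u} u⁻¹ → u ⊗ u⁻¹ ≡ one → x ⊗ u ≡ y ⊗ u → x ≡ y
⊗-cancelʳ {x} {y} {u} u⁻¹ u⊗u⁻¹≡1 xu≡yu = begin
  x                  ≡⟨ sym (⊗-identityʳ x) ⟩
  x ⊗ one            ≡⟨ cong (x ⊗_) (sym u⊗u⁻¹≡1) ⟩
  x ⊗ (u ⊗ u⁻¹)      ≡⟨ sym (⊗-assoc x u u⁻¹) ⟩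
  (x ⊗ u) ⊗ u⁻¹      ≡⟨ cong (_⊗ u⁻¹) xu≡yu ⟩
  (y ⊗ u) ⊗ u⁻¹      ≡⟨ ⊗-assoc y u u⁻¹ ⟩
  y ⊗ (u ⊗ u⁻¹)      ≡⟨ cong (y ⊗_) u⊗u⁻¹≡1 ⟩
  y ⊗ one            ≡⟨ ⊗-identityʳ y ⟩
  y                  ∎
  where open ≡-Reasoning

-- Three-term recurrences

δ : ℕ → ℕ → ℚ
δ l k = if l ≡ᵇ k then 1ℚ else 0ℚ

δ-refl : ∀ k → δ k k ≡ 1ℚ
δ-refl k rewrite dec-true (k ℕ.≟ k) refl = refl

δ-≢ : ∀ {l k} → l ≢ k → δ l k ≡ 0ℚ
δ-≢ {l} {k} l≢k rewrite dec-false (l ℕ.≟ k) l≢k = refl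

-- Δ 2 f is the Laplacian of f on the path, and Δ 4 f adds the rung term 2 f.
Δ : ℚ → (ℕ → ℚ) → ℕ → ℚ
Δ c f k = c *ℚ f k -ℚ f (k ∸ 1) -ℚ f (suc k)

Δ-at : ∀ c f k {x y z} → f (k ∸ 1) ≡ x → f k ≡ y → f (suc k) ≡ z → Δ c f k ≡ c *ℚ y -ℚ x -ℚ z
Δ-at c f k refl refl refl = refl

Δ-local : ∀ c f g k → f (k ∸ 1) ≡ g (k ∸ 1) → f k ≡ g k → f (suc k) ≡ g (suc k) → Δ c f k ≡ Δ c g k
Δ-local c f g k f₋≡g₋ f≡g f₊≡g₊ = Δ-at c f k f₋≡g₋ f≡g f₊≡g₊

Δ-scaleʳ : ∀ c f a k → Δ c (λ m → f m *ℚ a) k ≡ Δ c f k *ℚ a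
Δ-scaleʳ c f a k = solve 5 (λ c a x y z → c :* (x :* a) :- y :* a :- z :* a := (c :* x :- y :- z) :* a) refl c a (f k) (f (k ∸ 1)) (f (suc k))
  where open ℚ-Solver

Δ-scaleˡ : ∀ c f a k → Δ c (λ m → a *ℚ f m) k ≡ a *ℚ Δ c f k
Δ-scaleˡ c f a k = solve 5 (λ c a x y z → c :* (a :* x) :- a :* y :- a :* z := a :* (c :* x :- y :- z)) refl c a (f k) (f (k ∸ 1)) (f (suc k))
  where open ℚ-Solver

m>n⇒m∸n≡1+[m∸1+n] : ∀ {m n} → n < m → m ∸ n ≡ suc (m ∸ suc n)
m>n⇒m∸n≡1+[m∸1+n] {suc m} {zero} _ = refl
m>n⇒m∸n≡1+[m∸1+n] {suc m} {suc n} (s≤s n<m) = m>n⇒m∸n≡1+[m∸1+n] n<m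

Δ-reflect : ∀ c f {m k} → 1 ≤ k → k < m → Δ c (λ l → f (m ∸ l)) k ≡ Δ c f (m ∸ k)
Δ-reflect c f {m} {suc k} _ k<m = begin
  c *ℚ f x -ℚ f (m ∸ k) -ℚ f (m ∸ suc (suc k))    ≡⟨ cong₂ (λ y z → c *ℚ f x -ℚ f y -ℚ f z) (m>n⇒m∸n≡1+[m∸1+n] (ℕ.<⇒≤ k<m))
                                                                                              (sym (cong (_∸ 1) (m>n⇒m∸n≡1+[m∸1+n] k<m))) ⟩
  c *ℚ f x -ℚ f (suc x) -ℚ f (x ∸ 1)               ≡⟨ solve 4 (λ c a b d → c :* a :- b :- d := c :* a :- d :- b) refl c (f x) (f (suc x)) (f (x ∸ 1)) ⟩
  c *ℚ f x -ℚ f (x ∸ 1) -ℚ f (suc x)               ∎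
  where
  open ≡-Reasoning
  open ℚ-Solver
  x : ℕ
  x = m ∸ suc k

Δ≡0⇒recurrence : ∀ c f k → Δ c f k ≡ 0ℚ → f (suc k) ≡ c *ℚ f k -ℚ f (k ∸ 1)
Δ≡0⇒recurrence c f k Δ≡0 = begin
  f (suc k)                                     ≡⟨ solve 4 (λ c x y z → z := c :* x :- y :- (c :* x :- y :- z)) refl c (f k) (f (k ∸ 1)) (f (suc k)) ⟩
  c *ℚ f k -ℚ f (k ∸ 1) -ℚ Δ c f k             ≡⟨ cong (λ e → c *ℚ f k -ℚ f (k ∸ 1) -ℚ e) Δ≡0 ⟩
  c *ℚ f k -ℚ f (k ∸ 1) -ℚ 0ℚ                  ≡⟨ solve 1 (λ x → x :- con 0ℚ := x) refl (c *ℚ f k -ℚ f (k ∸ 1)) ⟩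
  c *ℚ f k -ℚ f (k ∸ 1)                         ∎
  where
  open ≡-Reasoning
  open ℚ-Solver

neumannSolution : ℚ → ℕ → ℚ
neumannSolution c zero = 1ℚ
neumannSolution c (suc zero) = 1ℚ
neumannSolution c (suc (suc k)) = c *ℚ neumannSolution c (suc k) -ℚ neumannSolution c k

neumann-recurrence : ∀ c f n → f 0 ≡ f 1 → (∀ k → 1 ≤ k → k ≤ n → Δ c f k ≡ 0ℚ) →
                     ∀ k → k ≤ suc n → f k ≡ neumannSolution c k *ℚ f 1
neumann-recurrence c f n f₀≡f₁ Δf≡0 = at
  where
  S : ℕ → ℚ
  S = neumannSolution c
  consecutive : ∀ k → k ≤ n → f k ≡ S k *ℚ f 1 × f (suc k) ≡ S (suc k) *ℚ f 1
  consecutive zero _ = trans f₀≡f₁ (sym (ℚ.*-identityˡ (f 1))) , sym (ℚ.*-identityˡ (f 1))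
  consecutive (suc k) k+1≤n = f₁ , (begin
      f (suc (suc k))                          ≡⟨ Δ≡0⇒recurrence c f (suc k) (Δf≡0 (suc k) (s≤s z≤n) k+1≤n) ⟩
      c *ℚ f (suc k) -ℚ f k                    ≡⟨ cong₂ (λ x y → c *ℚ x -ℚ y) f₁ f₀ ⟩
      c *ℚ (S (suc k) *ℚ f 1) -ℚ S k *ℚ f 1    ≡⟨ solve 4 (λ c s₁ s₀ x → c :* (s₁ :* x) :- s₀ :* x := (c :* s₁ :- s₀) :* x) refl c (S (suc k)) (S k) (f 1) ⟩
      S (suc (suc k)) *ℚ f 1                   ∎)
    where
    open ≡-Reasoning
    open ℚ-Solver
    ih : f k ≡ S k *ℚ f 1 × f (suc k) ≡ S (suc k) *ℚ f 1
    ih = consecutive k (ℕ.<⇒≤ k+1≤n)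
    f₀ : f k ≡ S k *ℚ f 1
    f₀ = proj₁ ih
    f₁ : f (suc k) ≡ S (suc k) *ℚ f 1
    f₁ = proj₂ ih
  at : ∀ k → k ≤ suc n → f k ≡ S k *ℚ f 1
  at zero _ = proj₁ (consecutive 0 z≤n)
  at (suc k) (s≤s k≤n) = proj₂ (consecutive k k≤n)

neumannSolution-2 : ∀ k → neumannSolution (+ 2 / 1) k ≡ 1ℚ
neumannSolution-2 zero = refl
neumannSolution-2 (suc zero) = refl
neumannSolution-2 (suc (suc k)) rewrite neumannSolution-2 (suc k) | neumannSolution-2 k = refl

A : ℕ → ℚ
A = neumannSolution (+ 4 / 1)

dA : ℕ → ℚ
dA k = A (suc k) -ℚ A k

Δ-A : ∀ k → 1 ≤ k → Δ (+ 4 / 1) A k ≡ 0ℚ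
Δ-A (suc k) _ = solve 2 (λ x y → con (+ 4 / 1) :* x :- y :- (con (+ 4 / 1) :* x :- y) := con 0ℚ) refl (A (suc k)) (A k)
  where open ℚ-Solver

dA-suc : ∀ k → dA (suc k) ≡ (A (suc k) +ℚ A (suc k)) +ℚ dA k
dA-suc k = solve 2 (λ a₀ a₁ → con (+ 4 / 1) :* a₁ :- a₀ :- a₁ := (a₁ :+ a₁) :+ (a₁ :- a₀)) refl (A k) (A (suc k))
  where open ℚ-Solver

A≥1×dA≥0 : ∀ k → 1ℚ ≤ℚ A k × 0ℚ ≤ℚ dA k
A≥1×dA≥0 zero = ℚ.≤-refl , ℚ.≤-refl
A≥1×dA≥0 (suc k) = A≥1 , subst (0ℚ ≤ℚ_) (sym (dA-suc k)) (ℚ.≤-trans (ℚ.nonNegative⁻¹ _) (ℚ.+-mono-≤ (ℚ.+-mono-≤ A≥1 A≥1) (proj₂ ih)))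
  where
  open ℚ-Solver
  ih : 1ℚ ≤ℚ A k × 0ℚ ≤ℚ dA k
  ih = A≥1×dA≥0 k
  A≥1 : 1ℚ ≤ℚ A (suc k)
  A≥1 = subst (1ℚ ≤ℚ_) (solve 2 (λ a b → a :+ (b :- a) := b) refl (A k) (A (suc k))) (ℚ.+-mono-≤ (proj₁ ih) (proj₂ ih))

dA-nonZero : ∀ {n} → 1 ≤ n → NonZero (dA n)
dA-nonZero {suc n} _ = >-nonZero (subst (0ℚ <ℚ_) (sym (dA-suc n))
  (ℚ.<-≤-trans (ℚ.positive⁻¹ _) (ℚ.+-mono-≤ (ℚ.+-mono-≤ A≥1 A≥1) (proj₂ (A≥1×dA≥0 n)))))
  where A≥1 = proj₁ (A≥1×dA≥0 (suc n))

A-addition : ∀ p q → A (suc p) *ℚ A (suc q) -ℚ A p *ℚ A q ≡ dA (p + q)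
A-addition zero q = solve 2 (λ a₀ a₁ → con 1ℚ :* a₁ :- con 1ℚ :* a₀ := a₁ :- a₀) refl (A q) (A (suc q))
  where open ℚ-Solver
A-addition (suc p) q = begin
  A (suc (suc p)) *ℚ A (suc q) -ℚ A (suc p) *ℚ A q    ≡⟨ solve 4 (λ a₀ a₁ b₀ b₁ → (con (+ 4 / 1) :* a₁ :- a₀) :* b₁ :- a₁ :* b₀
                                                                         := a₁ :* (con (+ 4 / 1) :* b₁ :- b₀) :- a₀ :* b₁) refl (A p) (A (suc p)) (A q) (A (suc q)) ⟩
  A (suc p) *ℚ A (suc (suc q)) -ℚ A p *ℚ A (suc q)    ≡⟨ A-addition p (suc q) ⟩
  dA (p + suc q)                                      ≡⟨ cong dA (ℕ.+-suc p q) ⟩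
  dA (suc p + q)                                      ∎
  where
  open ≡-Reasoning
  open ℚ-Solver

module Green (n : ℕ) where

  B : ℕ → ℚ
  B k = A (suc n ∸ k)

  G : ℕ → ℕ → ℚ
  G l k = A (k ⊓ l) *ℚ B (k ⊔ l)

  G-below : ∀ {l k} → k ≤ l → G l k ≡ A k *ℚ B l
  G-below k≤l = cong₂ (λ a b → A a *ℚ B b) (ℕ.m≤n⇒m⊓n≡m k≤l) (ℕ.m≤n⇒m⊔n≡n k≤l)

  G-above : ∀ {l k} → l ≤ k → G l k ≡ A l *ℚ B k
  G-above l≤k = cong₂ (λ a b → A a *ℚ B b) (ℕ.m≥n⇒m⊓n≡n l≤k) (ℕ.m≥n⇒m⊔n≡m l≤k)

  G-neumann₀ : ∀ {l} → 1 ≤ l → G l 0 ≡ G l 1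
  G-neumann₀ {l} 1≤l = trans (G-below {l} z≤n) (sym (G-below 1≤l))

  G-neumannₙ : ∀ {l} → l ≤ n → G l (suc n) ≡ G l n
  G-neumannₙ {l} l≤n = begin
    G l (suc n)                ≡⟨ G-above (ℕ.m≤n⇒m≤1+n l≤n) ⟩
    A l *ℚ A (suc n ∸ suc n)   ≡⟨ cong (λ m → A l *ℚ A m) (ℕ.n∸n≡0 n) ⟩
    A l *ℚ A 1                 ≡⟨ cong (λ m → A l *ℚ A m) (sym (ℕ.m+n∸n≡m 1 n)) ⟩
    A l *ℚ B n                 ≡⟨ sym (G-above l≤n) ⟩
    G l n                      ∎
    where open ≡-Reasoning

  Δ-B : ∀ {k} → 1 ≤ k → k ≤ n → Δ (+ 4 / 1) B k ≡ 0ℚ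
  Δ-B {k} 1≤k k≤n = trans (Δ-reflect (+ 4 / 1) A 1≤k (s≤s k≤n))
    (Δ-A (suc n ∸ k) (subst (1 ≤_) (sym (m>n⇒m∸n≡1+[m∸1+n] (s≤s k≤n))) (s≤s z≤n)))

  Δ-G : ∀ l {k} → 1 ≤ k → k ≤ n → Δ (+ 4 / 1) (G l) k ≡ dA n *ℚ δ l k
  Δ-G l {k@(suc k′)} 1≤k k≤n with ℕ.<-cmp k l
  ... | tri< k<l k≢l _ = begin
    Δ (+ 4 / 1) (G l) k                       ≡⟨ Δ-local (+ 4 / 1) (G l) (λ m → A m *ℚ B l) k
                                                   (G-below (ℕ.≤-trans (ℕ.n≤1+n k′) (ℕ.<⇒≤ k<l))) (G-below (ℕ.<⇒≤ k<l)) (G-below k<l) ⟩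
    Δ (+ 4 / 1) (λ m → A m *ℚ B l) k          ≡⟨ Δ-scaleʳ (+ 4 / 1) A (B l) k ⟩
    Δ (+ 4 / 1) A k *ℚ B l                    ≡⟨ cong (_*ℚ B l) (Δ-A k 1≤k) ⟩
    0ℚ *ℚ B l                                 ≡⟨ solve 2 (λ b d → con 0ℚ :* b := d :* con 0ℚ) refl (B l) (dA n) ⟩
    dA n *ℚ 0ℚ                                ≡⟨ cong (dA n *ℚ_) (sym (δ-≢ (λ l≡k → k≢l (sym l≡k)))) ⟩
    dA n *ℚ δ l k                             ∎
    where
    open ≡-Reasoning
    open ℚ-Solver
  ... | tri> _ k≢l l<k = begin
    Δ (+ 4 / 1) (G l) k                       ≡⟨ Δ-local (+ 4 / 1) (G l) (λ m → A l *ℚ B m) k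
                                                   (G-above (ℕ.≤-pred l<k)) (G-above (ℕ.<⇒≤ l<k)) (G-above (ℕ.≤-trans (ℕ.<⇒≤ l<k) (ℕ.n≤1+n k))) ⟩
    Δ (+ 4 / 1) (λ m → A l *ℚ B m) k          ≡⟨ Δ-scaleˡ (+ 4 / 1) B (A l) k ⟩
    A l *ℚ Δ (+ 4 / 1) B k                    ≡⟨ cong (A l *ℚ_) (Δ-B 1≤k k≤n) ⟩
    A l *ℚ 0ℚ                                 ≡⟨ solve 2 (λ a d → a :* con 0ℚ := d :* con 0ℚ) refl (A l) (dA n) ⟩
    dA n *ℚ 0ℚ                                ≡⟨ cong (dA n *ℚ_) (sym (δ-≢ (λ l≡k → k≢l (sym l≡k)))) ⟩
    dA n *ℚ δ l k                             ∎
    where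
    open ≡-Reasoning
    open ℚ-Solver
  ... | tri≈ _ refl _ = begin
    Δ (+ 4 / 1) (G k) k                                                  ≡⟨ Δ-at (+ 4 / 1) (G k) k
                                                                              (trans (G-below (ℕ.n≤1+n k′)) (cong (A k′ *ℚ_) (B-suc k≤n)))
                                                                              (trans (G-below {k} ℕ.≤-refl) (cong (A k *ℚ_) (B-suc k≤n)))
                                                                              (G-above (ℕ.n≤1+n k)) ⟩
    + 4 / 1 *ℚ (A k *ℚ A (suc q)) -ℚ A k′ *ℚ A (suc q) -ℚ A k *ℚ A q   ≡⟨ solve 4 (λ a₀ a₁ b₀ b₁ → con (+ 4 / 1) :* (a₁ :* b₁) :- a₀ :* b₁ :- a₁ :* b₀
                                                                              := (con (+ 4 / 1) :* a₁ :- a₀) :* b₁ :- a₁ :* b₀) refl (A k′) (A k) (A q) (A (suc q)) ⟩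
    A (suc k) *ℚ A (suc q) -ℚ A k *ℚ A q                               ≡⟨ A-addition k q ⟩
    dA (k + q)                                                         ≡⟨ cong dA (ℕ.m+[n∸m]≡n k≤n) ⟩
    dA n                                                               ≡⟨ sym (ℚ.*-identityʳ (dA n)) ⟩
    dA n *ℚ 1ℚ                                                         ≡⟨ cong (dA n *ℚ_) (sym (δ-refl k)) ⟩
    dA n *ℚ δ k k                                                      ∎
    where
    open ≡-Reasoning
    open ℚ-Solver
    q : ℕ
    q = n ∸ k
    B-suc : ∀ {m} → m ≤ n → B m ≡ A (suc (n ∸ m))
    B-suc m≤n = cong A (m>n⇒m∸n≡1+[m∸1+n] (s≤s m≤n))

half : ℕ → ℚ
half m = + m / 2

-- half m is fromℚᵘ (mkℚᵘ (+ m) 1) by definition, so additivity can be checked in ℚᵘ.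
half-+ : ∀ m n → half (m + n) ≡ half m +ℚ half n
half-+ m n = ℚ.toℚᵘ-injective (begin
  toℚᵘ (half (m + n))                     ≈⟨ ℚ.toℚᵘ-fromℚᵘ (mkℚᵘ (+ (m + n)) 1) ⟩
  mkℚᵘ (+ (m + n)) 1                      ≈⟨ sum≃ ⟩
  mkℚᵘ (+ m) 1 ℚᵘ.+ mkℚᵘ (+ n) 1          ≈⟨ ℚᵘ.+-cong (ℚᵘ.≃-sym (ℚ.toℚᵘ-fromℚᵘ (mkℚᵘ (+ m) 1))) (ℚᵘ.≃-sym (ℚ.toℚᵘ-fromℚᵘ (mkℚᵘ (+ n) 1))) ⟩
  toℚᵘ (half m) ℚᵘ.+ toℚᵘ (half n)        ≈⟨ ℚᵘ.≃-sym (ℚ.toℚᵘ-homo-+ (half m) (half n)) ⟩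
  toℚᵘ (half m +ℚ half n)                 ∎)
  where
  open ℚᵘ.≃-Reasoning
  sum≃ : mkℚᵘ (+ (m + n)) 1 ℚᵘ.≃ mkℚᵘ (+ m) 1 ℚᵘ.+ mkℚᵘ (+ n) 1
  sum≃ = *≡* (trans (cong (ℤ._* + 4) (ℤ.pos-+ m n))
               (sym (trans (cong (ℤ._* + 2) (sym (ℤ.*-distribʳ-+ (+ 2) (+ m) (+ n)))) (ℤ.*-assoc (+ m ℤ.+ + n) (+ 2) (+ 2)))))

half-suc : ∀ m → half (suc m) ≡ half m +ℚ ½
half-suc m = trans (half-+ 1 m) (ℚ.+-comm ½ (half m))

Δ-half⊓ : ∀ l {k} → 1 ≤ k → Δ (+ 2 / 1) (λ m → half (m ⊓ l)) k ≡ ½ *ℚ δ l k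
Δ-half⊓ l {k@(suc k′)} _ with ℕ.<-cmp k l
... | tri< k<l k≢l _ = begin
  Δ (+ 2 / 1) (λ m → half (m ⊓ l)) k                           ≡⟨ Δ-at (+ 2 / 1) (λ m → half (m ⊓ l)) k
                                                                    (cong half (ℕ.m≤n⇒m⊓n≡m (ℕ.<⇒≤ (ℕ.<-trans (ℕ.n<1+n k′) k<l))))
                                                                    (trans (cong half (ℕ.m≤n⇒m⊓n≡m (ℕ.<⇒≤ k<l))) (half-suc k′))
                                                                    (trans (cong half (ℕ.m≤n⇒m⊓n≡m k<l)) (trans (half-suc k) (cong (_+ℚ ½) (half-suc k′)))) ⟩
  + 2 / 1 *ℚ (half k′ +ℚ ½) -ℚ half k′ -ℚ (half k′ +ℚ ½ +ℚ ½) ≡⟨ solve 1 (λ x → con (+ 2 / 1) :* (x :+ con ½) :- x :- (x :+ con ½ :+ con ½) := con ½ :* con 0ℚ)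
                                                                   refl (half k′) ⟩
  ½ *ℚ 0ℚ                                                      ≡⟨ cong (½ *ℚ_) (sym (δ-≢ (λ l≡k → k≢l (sym l≡k)))) ⟩
  ½ *ℚ δ l k                                                   ∎
  where
  open ≡-Reasoning
  open ℚ-Solver
... | tri≈ _ refl _ = begin
  Δ (+ 2 / 1) (λ m → half (m ⊓ k)) k                           ≡⟨ Δ-at (+ 2 / 1) (λ m → half (m ⊓ k)) k
                                                                    (cong half (ℕ.m≤n⇒m⊓n≡m (ℕ.n≤1+n k′)))
                                                                    (trans (cong half (ℕ.⊓-idem k)) (half-suc k′))
                                                                    (trans (cong half (ℕ.m≥n⇒m⊓n≡n (ℕ.n≤1+n k))) (half-suc k′)) ⟩
  + 2 / 1 *ℚ (half k′ +ℚ ½) -ℚ half k′ -ℚ (half k′ +ℚ ½)      ≡⟨ solve 1 (λ x → con (+ 2 / 1) :* (x :+ con ½) :- x :- (x :+ con ½) := con ½ :* con 1ℚ) refl (half k′) ⟩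
  ½ *ℚ 1ℚ                                                      ≡⟨ cong (½ *ℚ_) (sym (δ-refl k)) ⟩
  ½ *ℚ δ k k                                                   ∎
  where
  open ≡-Reasoning
  open ℚ-Solver
... | tri> _ k≢l l<k = begin
  Δ (+ 2 / 1) (λ m → half (m ⊓ l)) k                           ≡⟨ Δ-at (+ 2 / 1) (λ m → half (m ⊓ l)) k
                                                                    (cong half (ℕ.m≥n⇒m⊓n≡n (ℕ.≤-pred l<k)))
                                                                    (cong half (ℕ.m≥n⇒m⊓n≡n (ℕ.<⇒≤ l<k)))
                                                                    (cong half (ℕ.m≥n⇒m⊓n≡n (ℕ.m≤n⇒m≤1+n (ℕ.<⇒≤ l<k)))) ⟩
  + 2 / 1 *ℚ half l -ℚ half l -ℚ half l                        ≡⟨ solve 1 (λ y → con (+ 2 / 1) :* y :- y :- y := con ½ :* con 0ℚ) refl (half l) ⟩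
  ½ *ℚ 0ℚ                                                      ≡⟨ cong (½ *ℚ_) (sym (δ-≢ (λ l≡k → k≢l (sym l≡k)))) ⟩
  ½ *ℚ δ l k                                                   ∎
  where
  open ≡-Reasoning
  open ℚ-Solver

-- Potentials on the ladder

record Neumann (n : ℕ) (f : ℕ → ℚ) : Set where
  constructor neumann
  field
    left  : f 0 ≡ f 1
    right : f (suc n) ≡ f n

neumann-map₂ : ∀ {n f g} (F : ℚ → ℚ → ℚ) → Neumann n f → Neumann n g → Neumann n (λ k → F (f k) (g k))
neumann-map₂ F (neumann f₀ fₙ) (neumann g₀ gₙ) = neumann (cong₂ F f₀ g₀) (cong₂ F fₙ gₙ)

laplacian-neumann : ∀ n v s {k} → Neumann n (v s) → 1 ≤ k → k ≤ n →
                    laplacian n v s k ≡ (v s k -ℚ v (other s) k) +ℚ Δ (+ 2 / 1) (v s) k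
laplacian-neumann n v s {k} (neumann f₀≡f₁ fₙ₊₁≡fₙ) 1≤k k≤n = begin
  laplacian n v s k                                                        ≡⟨ cong₂ (λ x y → (f k -ℚ v (other s) k) +ℚ x +ℚ y) (left k 1≤k) right ⟩
  (f k -ℚ v (other s) k) +ℚ (f k -ℚ f (k ∸ 1)) +ℚ (f k -ℚ f (suc k))     ≡⟨ solve 4 (λ r a b d → r :+ (a :- b) :+ (a :- d) := r :+ (con (+ 2 / 1) :* a :- b :- d)) refl
                                                                                (f k -ℚ v (other s) k) (f k) (f (k ∸ 1)) (f (suc k)) ⟩
  (f k -ℚ v (other s) k) +ℚ Δ (+ 2 / 1) f k                               ∎
  where
  open ≡-Reasoning
  open ℚ-Solver
  f : ℕ → ℚ
  f = v s
  left : ∀ k → 1 ≤ k → (if 2 ≤ᵇ k then f k -ℚ f (k ∸ 1) else 0ℚ) ≡ f k -ℚ f (k ∸ 1)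
  left (suc zero) _ = sym (trans (cong (λ x → f 1 -ℚ x) f₀≡f₁) (ℚ.+-inverseʳ (f 1)))
  left (suc (suc k)) _ = refl
  right : (if k <ᵇ n then f k -ℚ f (suc k) else 0ℚ) ≡ f k -ℚ f (suc k)
  right with ℕ.m≤n⇒m<n∨m≡n k≤n
  ... | inj₁ k<n rewrite dec-true (k ℕ.<? n) k<n = refl
  ... | inj₂ refl rewrite dec-false (k ℕ.<? k) (ℕ.n≮n k) = sym (trans (cong (λ x → f k -ℚ x) fₙ₊₁≡fₙ) (ℚ.+-inverseʳ (f k)))

sign : Side → ℚ
sign P = 1ℚ
sign Q = -[1+ 0 ] / 1

sign²≡1 : ∀ s → sign s *ℚ sign s ≡ 1ℚ
sign²≡1 P = refl
sign²≡1 Q = refl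

ladderPotential : (ℕ → ℚ) → (ℕ → ℚ) → Potential
ladderPotential U W s k = U k +ℚ sign s *ℚ W k

ladderPotential-neumann : ∀ {n U W} → Neumann n U → Neumann n W → ∀ s → Neumann n (ladderPotential U W s)
ladderPotential-neumann U-neumann W-neumann s = neumann-map₂ (λ u w → u +ℚ sign s *ℚ w) U-neumann W-neumann

laplacian-ladderPotential : ∀ {n U W} → Neumann n U → Neumann n W → ∀ s {k} → 1 ≤ k → k ≤ n →
  laplacian n (ladderPotential U W) s k ≡ Δ (+ 2 / 1) U k +ℚ sign s *ℚ Δ (+ 4 / 1) W k
laplacian-ladderPotential {n} {U} {W} U-neumann W-neumann s {k} 1≤k k≤n =
  trans (laplacian-neumann n (ladderPotential U W) s (ladderPotential-neumann U-neumann W-neumann s) 1≤k k≤n)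
        (trans (cong (λ σ′ → (U k +ℚ sign s *ℚ W k -ℚ (U k +ℚ σ′ *ℚ W k)) +ℚ Δ (+ 2 / 1) (ladderPotential U W s) k) (sign-other s))
               (solve 7 (λ σ u₀ u₁ u₂ w₀ w₁ w₂ →
                   (u₁ :+ σ :* w₁ :- (u₁ :+ (:- σ) :* w₁)) :+ (con (+ 2 / 1) :* (u₁ :+ σ :* w₁) :- (u₀ :+ σ :* w₀) :- (u₂ :+ σ :* w₂))
                := (con (+ 2 / 1) :* u₁ :- u₀ :- u₂) :+ σ :* (con (+ 4 / 1) :* w₁ :- w₀ :- w₂))
                 refl (sign s) (U (k ∸ 1)) (U k) (U (suc k)) (W (k ∸ 1)) (W k) (W (suc k))))
  where
  open ℚ-Solver
  sign-other : ∀ s → sign (other s) ≡ - sign s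
  sign-other P = refl
  sign-other Q = refl

ind-decomposition : ∀ s i s′ k → ind (s , i) s′ k ≡ (1ℚ +ℚ sign s *ℚ sign s′) *ℚ ½ *ℚ δ i k
ind-decomposition s i s′ k = cases s s′
  where
  open ℚ-Solver
  cases : ∀ s s′ → ind (s , i) s′ k ≡ (1ℚ +ℚ sign s *ℚ sign s′) *ℚ ½ *ℚ δ i k
  cases P P = solve 1 (λ d → d := (con 1ℚ :+ con 1ℚ :* con 1ℚ) :* con ½ :* d) refl (δ i k)
  cases P Q = solve 1 (λ d → con 0ℚ := (con 1ℚ :+ con 1ℚ :* con (sign Q)) :* con ½ :* d) refl (δ i k)
  cases Q P = solve 1 (λ d → con 0ℚ := (con 1ℚ :+ con (sign Q) :* con 1ℚ) :* con ½ :* d) refl (δ i k)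
  cases Q Q = solve 1 (λ d → d := (con 1ℚ :+ con (sign Q) :* con (sign Q)) :* con ½ :* d) refl (δ i k)

-- Uniqueness of potential differences

*-cancelˡ-≡0 : ∀ d .{{_ : NonZero d}} {x} → d *ℚ x ≡ 0ℚ → x ≡ 0ℚ
*-cancelˡ-≡0 d {x} dx≡0 = begin
  x                  ≡⟨ sym (ℚ.*-identityˡ x) ⟩
  1ℚ *ℚ x            ≡⟨ cong (_*ℚ x) (sym (ℚ.*-inverseˡ d)) ⟩
  1/ d *ℚ d *ℚ x     ≡⟨ ℚ.*-assoc (1/ d) d x ⟩
  1/ d *ℚ (d *ℚ x)   ≡⟨ cong (1/ d *ℚ_) dx≡0 ⟩
  1/ d *ℚ 0ℚ         ≡⟨ ℚ.*-zeroʳ (1/ d) ⟩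
  0ℚ                 ∎
  where open ≡-Reasoning

Δ2-neumann-constant : ∀ {n} f → f 0 ≡ f 1 → (∀ k → 1 ≤ k → k ≤ n → Δ (+ 2 / 1) f k ≡ 0ℚ) →
                      ∀ {k} → k ≤ suc n → f k ≡ f 1
Δ2-neumann-constant {n} f f₀≡f₁ Δf≡0 {k} k≤1+n =
  trans (neumann-recurrence (+ 2 / 1) f n f₀≡f₁ Δf≡0 k k≤1+n)
        (trans (cong (_*ℚ f 1) (neumannSolution-2 k)) (ℚ.*-identityˡ (f 1)))

Δ4-neumann-zero : ∀ {n} f → 1 ≤ n → Neumann n f → (∀ k → 1 ≤ k → k ≤ n → Δ (+ 4 / 1) f k ≡ 0ℚ) →
                  ∀ {k} → k ≤ suc n → f k ≡ 0ℚ
Δ4-neumann-zero {n} f 1≤n (neumann f₀≡f₁ fₙ₊₁≡fₙ) Δf≡0 {k} k≤1+n =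
  trans (f≡A*f₁ k k≤1+n) (trans (cong (A k *ℚ_) f₁≡0) (ℚ.*-zeroʳ (A k)))
  where
  open ℚ-Solver
  f≡A*f₁ : ∀ k → k ≤ suc n → f k ≡ A k *ℚ f 1
  f≡A*f₁ = neumann-recurrence (+ 4 / 1) f n f₀≡f₁ Δf≡0
  f₁≡0 : f 1 ≡ 0ℚ
  f₁≡0 = *-cancelˡ-≡0 (dA n) {{dA-nonZero 1≤n}} (begin
    dA n *ℚ f 1                             ≡⟨ solve 3 (λ a₀ a₁ x → (a₁ :- a₀) :* x := a₁ :* x :- a₀ :* x) refl (A n) (A (suc n)) (f 1) ⟩
    A (suc n) *ℚ f 1 -ℚ A n *ℚ f 1          ≡⟨ cong₂ _-ℚ_ (sym (f≡A*f₁ (suc n) ℕ.≤-refl)) (sym (f≡A*f₁ n (ℕ.n≤1+n n))) ⟩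
    f (suc n) -ℚ f n                        ≡⟨ cong (_-ℚ f n) fₙ₊₁≡fₙ ⟩
    f n -ℚ f n                              ≡⟨ ℚ.+-inverseʳ (f n) ⟩
    0ℚ                                      ∎)
    where open ≡-Reasoning

laplacian-sum×difference : ∀ {n} (h : Potential) → (∀ s → Neumann n (h s)) → ∀ {k} → 1 ≤ k → k ≤ n →
    Δ (+ 2 / 1) (λ m → h P m +ℚ h Q m) k ≡ laplacian n h P k +ℚ laplacian n h Q k
  × Δ (+ 4 / 1) (λ m → h P m -ℚ h Q m) k ≡ laplacian n h P k -ℚ laplacian n h Q k
laplacian-sum×difference {n} h h-neumann {k} 1≤k k≤n =
    trans (solve 6 (λ p₀ p₁ p₂ q₀ q₁ q₂ → con (+ 2 / 1) :* (p₁ :+ q₁) :- (p₀ :+ q₀) :- (p₂ :+ q₂)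
                        := ((p₁ :- q₁) :+ (con (+ 2 / 1) :* p₁ :- p₀ :- p₂)) :+ ((q₁ :- p₁) :+ (con (+ 2 / 1) :* q₁ :- q₀ :- q₂))) refl
                   (h P (k ∸ 1)) (h P k) (h P (suc k)) (h Q (k ∸ 1)) (h Q k) (h Q (suc k)))
          (sym (cong₂ _+ℚ_ lapP lapQ))
  , trans (solve 6 (λ p₀ p₁ p₂ q₀ q₁ q₂ → con (+ 4 / 1) :* (p₁ :- q₁) :- (p₀ :- q₀) :- (p₂ :- q₂)
                        := ((p₁ :- q₁) :+ (con (+ 2 / 1) :* p₁ :- p₀ :- p₂)) :- ((q₁ :- p₁) :+ (con (+ 2 / 1) :* q₁ :- q₀ :- q₂))) refl
                   (h P (k ∸ 1)) (h P k) (h P (suc k)) (h Q (k ∸ 1)) (h Q k) (h Q (suc k)))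
          (sym (cong₂ _-ℚ_ lapP lapQ))
  where
  open ℚ-Solver
  lapP : laplacian n h P k ≡ (h P k -ℚ h Q k) +ℚ Δ (+ 2 / 1) (h P) k
  lapP = laplacian-neumann n h P (h-neumann P) 1≤k k≤n
  lapQ : laplacian n h Q k ≡ (h Q k -ℚ h P k) +ℚ Δ (+ 2 / 1) (h Q) k
  lapQ = laplacian-neumann n h Q (h-neumann Q) 1≤k k≤n

harmonic⇒constant : ∀ {n} (h : Potential) → 1 ≤ n → (∀ s → Neumann n (h s)) →
  (∀ s k → 1 ≤ k → k ≤ n → laplacian n h s k ≡ 0ℚ) →
  ∀ s {k} → 1 ≤ k → k ≤ n → h s k ≡ (h P 1 +ℚ h Q 1) *ℚ ½
harmonic⇒constant {n} h 1≤n h-neumann h-harmonic s {k} 1≤k k≤n = begin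
  h s k                                          ≡⟨ decomposition s ⟩
  (U k +ℚ sign s *ℚ W k) *ℚ ½                    ≡⟨ cong₂ (λ u w → (u +ℚ sign s *ℚ w) *ℚ ½)
                                                       (Δ2-neumann-constant U (Neumann.left (neumann-map₂ _+ℚ_ (h-neumann P) (h-neumann Q))) Δ2U≡0 k≤1+n)
                                                       (Δ4-neumann-zero W 1≤n (neumann-map₂ _-ℚ_ (h-neumann P) (h-neumann Q)) Δ4W≡0 k≤1+n) ⟩
  (U 1 +ℚ sign s *ℚ 0ℚ) *ℚ ½                     ≡⟨ solve 2 (λ σ u → (u :+ σ :* con 0ℚ) :* con ½ := u :* con ½) refl (sign s) (U 1) ⟩
  U 1 *ℚ ½                                       ∎
  where
  open ≡-Reasoning
  open ℚ-Solver
  U W : ℕ → ℚ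
  U m = h P m +ℚ h Q m
  W m = h P m -ℚ h Q m
  k≤1+n : k ≤ suc n
  k≤1+n = ℕ.m≤n⇒m≤1+n k≤n
  decomposition : ∀ s → h s k ≡ (U k +ℚ sign s *ℚ W k) *ℚ ½
  decomposition P = solve 2 (λ p q → p := ((p :+ q) :+ con 1ℚ :* (p :- q)) :* con ½) refl (h P k) (h Q k)
  decomposition Q = solve 2 (λ p q → q := ((p :+ q) :+ con (sign Q) :* (p :- q)) :* con ½) refl (h P k) (h Q k)
  Δ2U≡0 : ∀ m → 1 ≤ m → m ≤ n → Δ (+ 2 / 1) U m ≡ 0ℚ
  Δ2U≡0 m 1≤m m≤n = trans (proj₁ (laplacian-sum×difference h h-neumann 1≤m m≤n)) (cong₂ _+ℚ_ (h-harmonic P m 1≤m m≤n) (h-harmonic Q m 1≤m m≤n))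
  Δ4W≡0 : ∀ m → 1 ≤ m → m ≤ n → Δ (+ 4 / 1) W m ≡ 0ℚ
  Δ4W≡0 m 1≤m m≤n = trans (proj₂ (laplacian-sum×difference h h-neumann 1≤m m≤n)) (cong₂ _-ℚ_ (h-harmonic P m 1≤m m≤n) (h-harmonic Q m 1≤m m≤n))

flow-unique : ∀ {n a b} {v v′ : Potential} → 1 ≤ n →
  (∀ s → Neumann n (v s)) → (∀ s → Neumann n (v′ s)) →
  UnitFlowPotential n a b v → UnitFlowPotential n a b v′ →
  ∀ {s k s′ k′} → 1 ≤ k → k ≤ n → 1 ≤ k′ → k′ ≤ n → v′ s k -ℚ v′ s′ k′ ≡ v s k -ℚ v s′ k′
flow-unique {n} {a} {b} {v} {v′} 1≤n v-neumann v′-neumann v-flow v′-flow {s} {k} {s′} {k′} 1≤k k≤n 1≤k′ k′≤n = begin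
  v′ s k -ℚ v′ s′ k′                           ≡⟨ solve 4 (λ x x′ y y′ → x′ :- y′ := (x :- y) :+ ((x′ :- x) :- (y′ :- y))) refl (v s k) (v′ s k) (v s′ k′) (v′ s′ k′) ⟩
  (v s k -ℚ v s′ k′) +ℚ (h s k -ℚ h s′ k′)     ≡⟨ cong₂ (λ x y → (v s k -ℚ v s′ k′) +ℚ (x -ℚ y)) (constant s 1≤k k≤n) (constant s′ 1≤k′ k′≤n) ⟩
  (v s k -ℚ v s′ k′) +ℚ (c -ℚ c)               ≡⟨ solve 2 (λ x c → x :+ (c :- c) := x) refl (v s k -ℚ v s′ k′) c ⟩
  v s k -ℚ v s′ k′                             ∎
  where
  open ≡-Reasoning
  open ℚ-Solver
  h : Potential
  h s m = v′ s m -ℚ v s m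
  h-neumann : ∀ s → Neumann n (h s)
  h-neumann s = neumann-map₂ _-ℚ_ (v′-neumann s) (v-neumann s)
  h-harmonic : ∀ s m → 1 ≤ m → m ≤ n → laplacian n h s m ≡ 0ℚ
  h-harmonic s m 1≤m m≤n = begin
    laplacian n h s m                                         ≡⟨ laplacian-neumann n h s (h-neumann s) 1≤m m≤n ⟩
    (h s m -ℚ h (other s) m) +ℚ Δ (+ 2 / 1) (h s) m           ≡⟨ solve 8 (λ x x′ y y′ z z′ w w′ →
        ((x′ :- x) :- (y′ :- y)) :+ (con (+ 2 / 1) :* (x′ :- x) :- (z′ :- z) :- (w′ :- w))
        := ((x′ :- y′) :+ (con (+ 2 / 1) :* x′ :- z′ :- w′)) :- ((x :- y) :+ (con (+ 2 / 1) :* x :- z :- w))) refl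
        (v s m) (v′ s m) (v (other s) m) (v′ (other s) m) (v s (m ∸ 1)) (v′ s (m ∸ 1)) (v s (suc m)) (v′ s (suc m)) ⟩
    ((v′ s m -ℚ v′ (other s) m) +ℚ Δ (+ 2 / 1) (v′ s) m)
      -ℚ ((v s m -ℚ v (other s) m) +ℚ Δ (+ 2 / 1) (v s) m)     ≡⟨ cong₂ _-ℚ_ (sym (laplacian-neumann n v′ s (v′-neumann s) 1≤m m≤n))
                                                                               (sym (laplacian-neumann n v s (v-neumann s) 1≤m m≤n)) ⟩
    laplacian n v′ s m -ℚ laplacian n v s m                   ≡⟨ cong₂ _-ℚ_ (v′-flow s m 1≤m m≤n) (v-flow s m 1≤m m≤n) ⟩
    (ind a s m -ℚ ind b s m) -ℚ (ind a s m -ℚ ind b s m)      ≡⟨ ℚ.+-inverseʳ (ind a s m -ℚ ind b s m) ⟩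
    0ℚ                                                        ∎
  c : ℚ
  c = (h P 1 +ℚ h Q 1) *ℚ ½
  constant : ∀ s {k} → 1 ≤ k → k ≤ n → h s k ≡ c
  constant = harmonic⇒constant h 1≤n h-neumann h-harmonic

-- The laplacian only reads values at 1..n, so a potential may be replaced by its reflection at
-- the ends, which satisfies the Neumann conditions.
clamp : ℕ → ℕ → ℕ
clamp n zero = 1
clamp n (suc k) = suc k ⊓ n

clamp-inRange : ∀ {n k} → 1 ≤ k → k ≤ n → clamp n k ≡ k
clamp-inRange {k = suc k} _ k≤n = ℕ.m≤n⇒m⊓n≡m k≤n

clamped : ℕ → Potential → Potential
clamped n v s k = v s (clamp n k)

clamped-neumann : ∀ {n} v s → 1 ≤ n → Neumann n (clamped n v s)
clamped-neumann {n} v s 1≤n = neumann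
  (cong (v s) (sym (clamp-inRange ℕ.≤-refl 1≤n)))
  (cong (v s) (trans (ℕ.m≥n⇒m⊓n≡n (ℕ.n≤1+n n)) (sym (clamp-inRange 1≤n ℕ.≤-refl))))

if-cong : ∀ b {x y : ℚ} → (T b → x ≡ y) → (if b then x else 0ℚ) ≡ (if b then y else 0ℚ)
if-cong true x≡y = x≡y _
if-cong false _ = refl

laplacian-clamped : ∀ {n} v s {k} → 1 ≤ k → k ≤ n → laplacian n (clamped n v) s k ≡ laplacian n v s k
laplacian-clamped {n} v s {k} 1≤k k≤n =
  cong₂ _+ℚ_ (cong₂ _+ℚ_ (cong₂ _-ℚ_ (at s) (at (other s)))
                         (if-cong (2 ≤ᵇ k) λ t → cong₂ _-ℚ_ (at s) (cong (v s) (clamp-inRange (ℕ.∸-monoˡ-≤ 1 (ℕ.≤ᵇ⇒≤ 2 k t))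
                                                                                               (ℕ.≤-trans (ℕ.m∸n≤m k 1) k≤n)))))
             (if-cong (k <ᵇ n) λ t → cong₂ _-ℚ_ (at s) (cong (v s) (clamp-inRange (s≤s z≤n) (ℕ.<ᵇ⇒< k n t))))
  where
  at : ∀ s → clamped n v s k ≡ v s k
  at s = cong (v s) (clamp-inRange 1≤k k≤n)

neumannFlow⇒isEffectiveResistance : ∀ {n s i t j} (v : Potential) → 1 ≤ i → i ≤ n → 1 ≤ j → j ≤ n →
  (∀ s → Neumann n (v s)) → UnitFlowPotential n (s , i) (t , j) v →
  IsEffectiveResistance n (s , i) (t , j) (v s i -ℚ v t j)
neumannFlow⇒isEffectiveResistance {n} {s} {i} {t} {j} v 1≤i i≤n 1≤j j≤n v-neumann v-flow = (v , v-flow) , λ v′ v′-flow → begin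
  v′ s i -ℚ v′ t j                         ≡⟨ sym (cong₂ _-ℚ_ (cong (v′ s) (clamp-inRange 1≤i i≤n)) (cong (v′ t) (clamp-inRange 1≤j j≤n))) ⟩
  clamped n v′ s i -ℚ clamped n v′ t j     ≡⟨ flow-unique {a = s , i} {b = t , j} 1≤n v-neumann (λ s → clamped-neumann v′ s 1≤n) v-flow
                                                 (λ s k 1≤k k≤n → trans (laplacian-clamped v′ s 1≤k k≤n) (v′-flow s k 1≤k k≤n)) 1≤i i≤n 1≤j j≤n ⟩
  v s i -ℚ v t j                           ∎
  where
  open ≡-Reasoning
  1≤n : 1 ≤ n
  1≤n = ℕ.≤-trans 1≤i i≤n

-- The flow potential and the resistance in ℚ

module UnitFlow {n : ℕ} (1≤n : 1 ≤ n) (s : Side) (i : ℕ) (t : Side) (j : ℕ) where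
  open Green n

  instance
    dA≢0 : NonZero (dA n)
    dA≢0 = dA-nonZero 1≤n

  κ : ℚ
  κ = ½ *ℚ 1/ dA n

  U W : ℕ → ℚ
  U k = half (k ⊓ i) -ℚ half (k ⊓ j)
  W k = (sign s *ℚ G i k -ℚ sign t *ℚ G j k) *ℚ κ

  v : Potential
  v = ladderPotential U W

  module _ (1≤i : 1 ≤ i) (i≤n : i ≤ n) (1≤j : 1 ≤ j) (j≤n : j ≤ n) where

    -- At the left end, U 0 and half 1 -ℚ half 1 are closed terms that both compute to 0ℚ.
    U-neumann : Neumann n U
    U-neumann = neumann (sym (cong₂ (λ a b → half a -ℚ half b) (ℕ.m≤n⇒m⊓n≡m 1≤i) (ℕ.m≤n⇒m⊓n≡m 1≤j)))
                        (cong₂ (λ a b → half a -ℚ half b) (⊓-right i≤n) (⊓-right j≤n))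
      where
      ⊓-right : ∀ {l} → l ≤ n → suc n ⊓ l ≡ n ⊓ l
      ⊓-right l≤n = trans (ℕ.m≥n⇒m⊓n≡n (ℕ.m≤n⇒m≤1+n l≤n)) (sym (ℕ.m≥n⇒m⊓n≡n l≤n))

    W-neumann : Neumann n W
    W-neumann = neumann-map₂ (λ x y → (sign s *ℚ x -ℚ sign t *ℚ y) *ℚ κ)
                             (neumann (G-neumann₀ 1≤i) (G-neumannₙ i≤n)) (neumann (G-neumann₀ 1≤j) (G-neumannₙ j≤n))

    Δ-U : ∀ {k} → 1 ≤ k → Δ (+ 2 / 1) U k ≡ (δ i k -ℚ δ j k) *ℚ ½
    Δ-U {k} 1≤k = begin
      Δ (+ 2 / 1) U k                                            ≡⟨ solve 6 (λ a₀ a₁ a₂ b₀ b₁ b₂ → con (+ 2 / 1) :* (a₁ :- b₁) :- (a₀ :- b₀) :- (a₂ :- b₂)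
                                                                        := (con (+ 2 / 1) :* a₁ :- a₀ :- a₂) :- (con (+ 2 / 1) :* b₁ :- b₀ :- b₂)) refl
                                                                      (half ((k ∸ 1) ⊓ i)) (half (k ⊓ i)) (half (suc k ⊓ i))
                                                                      (half ((k ∸ 1) ⊓ j)) (half (k ⊓ j)) (half (suc k ⊓ j)) ⟩
      Δ (+ 2 / 1) (λ m → half (m ⊓ i)) k -ℚ Δ (+ 2 / 1) (λ m → half (m ⊓ j)) k
                                                                 ≡⟨ cong₂ _-ℚ_ (Δ-half⊓ i 1≤k) (Δ-half⊓ j 1≤k) ⟩
      ½ *ℚ δ i k -ℚ ½ *ℚ δ j k                                   ≡⟨ solve 2 (λ x y → con ½ :* x :- con ½ :* y := (x :- y) :* con ½) refl (δ i k) (δ j k) ⟩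
      (δ i k -ℚ δ j k) *ℚ ½                                      ∎
      where
      open ≡-Reasoning
      open ℚ-Solver

    Δ-W : ∀ {k} → 1 ≤ k → k ≤ n → Δ (+ 4 / 1) W k ≡ (sign s *ℚ δ i k -ℚ sign t *ℚ δ j k) *ℚ ½
    Δ-W {k} 1≤k k≤n = begin
      Δ (+ 4 / 1) W k                                            ≡⟨ solve 9 (λ σ τ c a₀ a₁ a₂ b₀ b₁ b₂ →
                                                                          con (+ 4 / 1) :* ((σ :* a₁ :- τ :* b₁) :* c) :- (σ :* a₀ :- τ :* b₀) :* c :- (σ :* a₂ :- τ :* b₂) :* c
                                                                        := (σ :* (con (+ 4 / 1) :* a₁ :- a₀ :- a₂) :- τ :* (con (+ 4 / 1) :* b₁ :- b₀ :- b₂)) :* c) refl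
                                                                      (sign s) (sign t) κ (G i (k ∸ 1)) (G i k) (G i (suc k)) (G j (k ∸ 1)) (G j k) (G j (suc k)) ⟩
      (sign s *ℚ Δ (+ 4 / 1) (G i) k -ℚ sign t *ℚ Δ (+ 4 / 1) (G j) k) *ℚ κ
                                                                 ≡⟨ cong₂ (λ x y → (sign s *ℚ x -ℚ sign t *ℚ y) *ℚ κ) (Δ-G i 1≤k k≤n) (Δ-G j 1≤k k≤n) ⟩
      (sign s *ℚ (dA n *ℚ δ i k) -ℚ sign t *ℚ (dA n *ℚ δ j k)) *ℚ κ
                                                                 ≡⟨ solve 6 (λ σ τ d x y e → (σ :* (d :* x) :- τ :* (d :* y)) :* (con ½ :* e)
                                                                                            := (σ :* x :- τ :* y) :* (con ½ :* (d :* e))) refl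
                                                                      (sign s) (sign t) (dA n) (δ i k) (δ j k) (1/ dA n) ⟩
      (sign s *ℚ δ i k -ℚ sign t *ℚ δ j k) *ℚ (½ *ℚ (dA n *ℚ 1/ dA n))
                                                                 ≡⟨ cong (λ x → (sign s *ℚ δ i k -ℚ sign t *ℚ δ j k) *ℚ (½ *ℚ x)) (ℚ.*-inverseʳ (dA n)) ⟩
      (sign s *ℚ δ i k -ℚ sign t *ℚ δ j k) *ℚ (½ *ℚ 1ℚ)        ∎
      where
      open ≡-Reasoning
      open ℚ-Solver

    v-neumann : ∀ s → Neumann n (v s)
    v-neumann = ladderPotential-neumann U-neumann W-neumann

    v-flow : UnitFlowPotential n (s , i) (t , j) v
    v-flow s′ k 1≤k k≤n = begin
      laplacian n v s′ k                                         ≡⟨ laplacian-ladderPotential U-neumann W-neumann s′ 1≤k k≤n ⟩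
      Δ (+ 2 / 1) U k +ℚ sign s′ *ℚ Δ (+ 4 / 1) W k              ≡⟨ cong₂ (λ x y → x +ℚ sign s′ *ℚ y) (Δ-U 1≤k) (Δ-W 1≤k k≤n) ⟩
      (δ i k -ℚ δ j k) *ℚ ½ +ℚ sign s′ *ℚ ((sign s *ℚ δ i k -ℚ sign t *ℚ δ j k) *ℚ ½)
                                                                 ≡⟨ solve 5 (λ σ τ ρ x y → (x :- y) :* con ½ :+ ρ :* ((σ :* x :- τ :* y) :* con ½)
                                                                        := (con 1ℚ :+ σ :* ρ) :* con ½ :* x :- (con 1ℚ :+ τ :* ρ) :* con ½ :* y) refl
                                                                      (sign s) (sign t) (sign s′) (δ i k) (δ j k) ⟩
      (1ℚ +ℚ sign s *ℚ sign s′) *ℚ ½ *ℚ δ i k -ℚ (1ℚ +ℚ sign t *ℚ sign s′) *ℚ ½ *ℚ δ j k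
                                                                 ≡⟨ sym (cong₂ _-ℚ_ (ind-decomposition s i s′ k) (ind-decomposition t j s′ k)) ⟩
      ind (s , i) s′ k -ℚ ind (t , j) s′ k                       ∎
      where
      open ≡-Reasoning
      open ℚ-Solver

    resistance : j ≤ i → (v s i -ℚ v t j -ℚ halfDiff i j) *ℚ (+ 2 / 1 *ℚ dA n)
                         ≡ A i *ℚ B i -ℚ + 2 / 1 *ℚ (sign s *ℚ sign t) *ℚ (A j *ℚ B i) +ℚ A j *ℚ B j
    resistance j≤i = begin
      (v s i -ℚ v t j -ℚ H) *ℚ (+ 2 / 1 *ℚ dA n)
          ≡⟨ cong (λ r → (r -ℚ H) *ℚ (+ 2 / 1 *ℚ dA n)) (cong₂ _-ℚ_ (cong₂ (λ u w → u +ℚ sign s *ℚ w) U-i W-i) (cong₂ (λ u w → u +ℚ sign t *ℚ w) U-j W-j)) ⟩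
      ((half j +ℚ H -ℚ half j) +ℚ sign s *ℚ ((sign s *ℚ p -ℚ sign t *ℚ q) *ℚ κ)
        -ℚ ((half j -ℚ half j) +ℚ sign t *ℚ ((sign s *ℚ q -ℚ sign t *ℚ r) *ℚ κ)) -ℚ H) *ℚ (+ 2 / 1 *ℚ dA n)
          ≡⟨ solve 9 (λ h H σ τ p q r c d →
                 ((h :+ H :- h) :+ σ :* ((σ :* p :- τ :* q) :* c) :- ((h :- h) :+ τ :* ((σ :* q :- τ :* r) :* c)) :- H) :* (con (+ 2 / 1) :* d)
              := ((σ :* σ) :* p :- con (+ 2 / 1) :* (σ :* τ) :* q :+ (τ :* τ) :* r) :* (con (+ 2 / 1) :* d :* c)) refl
              (half j) H (sign s) (sign t) p q r κ (dA n) ⟩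
      ((sign s *ℚ sign s) *ℚ p -ℚ + 2 / 1 *ℚ (sign s *ℚ sign t) *ℚ q +ℚ (sign t *ℚ sign t) *ℚ r) *ℚ (+ 2 / 1 *ℚ dA n *ℚ κ)
          ≡⟨ cong₂ (λ x y → (x *ℚ p -ℚ + 2 / 1 *ℚ (sign s *ℚ sign t) *ℚ q +ℚ y *ℚ r) *ℚ (+ 2 / 1 *ℚ dA n *ℚ κ)) (sign²≡1 s) (sign²≡1 t) ⟩
      (1ℚ *ℚ p -ℚ + 2 / 1 *ℚ (sign s *ℚ sign t) *ℚ q +ℚ 1ℚ *ℚ r) *ℚ (+ 2 / 1 *ℚ dA n *ℚ κ)
          ≡⟨ cong ((1ℚ *ℚ p -ℚ + 2 / 1 *ℚ (sign s *ℚ sign t) *ℚ q +ℚ 1ℚ *ℚ r) *ℚ_) 2dAκ≡1 ⟩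
      (1ℚ *ℚ p -ℚ + 2 / 1 *ℚ (sign s *ℚ sign t) *ℚ q +ℚ 1ℚ *ℚ r) *ℚ 1ℚ
          ≡⟨ solve 4 (λ σ p q r → (con 1ℚ :* p :- con (+ 2 / 1) :* σ :* q :+ con 1ℚ :* r) :* con 1ℚ := p :- con (+ 2 / 1) :* σ :* q :+ r) refl
               (sign s *ℚ sign t) p q r ⟩
      p -ℚ + 2 / 1 *ℚ (sign s *ℚ sign t) *ℚ q +ℚ r
          ∎
      where
      open ≡-Reasoning
      open ℚ-Solver
      H p q r : ℚ
      H = halfDiff i j
      p = A i *ℚ B i
      q = A j *ℚ B i
      r = A j *ℚ B j
      U-i : U i ≡ half j +ℚ H -ℚ half j
      U-i = cong₂ _-ℚ_ (trans (cong half (trans (ℕ.⊓-idem i) (sym (ℕ.m+[n∸m]≡n j≤i)))) (half-+ j (i ∸ j)))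
                       (cong half (ℕ.m≥n⇒m⊓n≡n j≤i))
      U-j : U j ≡ half j -ℚ half j
      U-j = cong₂ (λ a b → half a -ℚ half b) (ℕ.m≤n⇒m⊓n≡m j≤i) (ℕ.⊓-idem j)
      W-i : W i ≡ (sign s *ℚ p -ℚ sign t *ℚ q) *ℚ κ
      W-i = cong₂ (λ x y → (sign s *ℚ x -ℚ sign t *ℚ y) *ℚ κ) (G-below {i} ℕ.≤-refl) (G-above j≤i)
      W-j : W j ≡ (sign s *ℚ q -ℚ sign t *ℚ r) *ℚ κ
      W-j = cong₂ (λ x y → (sign s *ℚ x -ℚ sign t *ℚ y) *ℚ κ) (G-below j≤i) (G-below {j} ℕ.≤-refl)
      2dAκ≡1 : + 2 / 1 *ℚ dA n *ℚ κ ≡ 1ℚ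
      2dAκ≡1 = trans (solve 2 (λ d e → con (+ 2 / 1) :* d :* (con ½ :* e) := d :* e) refl (dA n) (1/ dA n)) (ℚ.*-inverseʳ (dA n))

ladder-resistance : ∀ {n i j} s t → 1 ≤ j → j ≤ i → i ≤ n →
  Σ ℚ λ r → IsEffectiveResistance n (s , i) (t , j) r
          × (r -ℚ halfDiff i j) *ℚ (+ 2 / 1 *ℚ dA n)
            ≡ A i *ℚ A (suc n ∸ i) -ℚ + 2 / 1 *ℚ (sign s *ℚ sign t) *ℚ (A j *ℚ A (suc n ∸ i)) +ℚ A j *ℚ A (suc n ∸ j)
ladder-resistance {n} {i} {j} s t 1≤j j≤i i≤n =
  v s i -ℚ v t j , neumannFlow⇒isEffectiveResistance v 1≤i i≤n 1≤j j≤n (v-neumann 1≤i i≤n 1≤j j≤n) (v-flow 1≤i i≤n 1≤j j≤n)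
                 , resistance 1≤i i≤n 1≤j j≤n j≤i
  where
  1≤i : 1 ≤ i
  1≤i = ℕ.≤-trans 1≤j j≤i
  j≤n : j ≤ n
  j≤n = ℕ.≤-trans j≤i i≤n
  open UnitFlow (ℕ.≤-trans 1≤i i≤n) s i t j

-- The closed form in ℚ(√3)

^-+ : ∀ x a b → x ^ (a + b) ≡ x ^ a ⊗ x ^ b
^-+ x zero b = sym (⊗-identityˡ (x ^ b))
^-+ x (suc a) b = trans (cong (x ⊗_) (^-+ x a b)) (sym (⊗-assoc x (x ^ a) (x ^ b)))

β : Q3
β = mkQ3 (+ 2 / 1) 1ℚ

α^k⊗β^k≡1 : ∀ k → α ^ k ⊗ β ^ k ≡ one
α^k⊗β^k≡1 zero = refl
α^k⊗β^k≡1 (suc k) = begin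
  α ⊗ α ^ k ⊗ (β ⊗ β ^ k)       ≡⟨ solve 2 (λ x y → con α :* x :* (con β :* y) := con α :* con β :* (x :* y)) refl (α ^ k) (β ^ k) ⟩
  α ⊗ β ⊗ (α ^ k ⊗ β ^ k)       ≡⟨ cong (α ⊗ β ⊗_) (α^k⊗β^k≡1 k) ⟩
  one                           ∎
  where
  open ≡-Reasoning
  open Q3-Solver

c₀ c₁ : Q3
c₀ = mkQ3 (+ 3 / 1) (-[1+ 0 ] / 1)
c₁ = mkQ3 (+ 3 / 1) 1ℚ

-- Binet's formula A k = (c₀ β^k + c₁ α^k) / 6 multiplied by 6 α^k, using α β = 1.
binet : Q3 → Q3
binet u = c₀ ⊕ c₁ ⊗ (u ⊗ u)

A-binet : ∀ k → nat 6 ⊗ (α ^ k ⊗ emb (A k)) ≡ binet (α ^ k)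
A-binet k = proj₁ (consecutive k)
  where
  open Q3-Solver
  consecutive : ∀ k → nat 6 ⊗ (α ^ k ⊗ emb (A k)) ≡ binet (α ^ k) × nat 6 ⊗ (α ^ suc k ⊗ emb (A (suc k))) ≡ binet (α ^ suc k)
  consecutive zero = refl , refl
  consecutive (suc k) = proj₂ ih , (begin
    nat 6 ⊗ (α ⊗ (α ⊗ x) ⊗ emb (+ 4 / 1 *ℚ A (suc k) -ℚ A k))  ≡⟨ cong (λ a → nat 6 ⊗ (α ⊗ (α ⊗ x) ⊗ (a ⊖ a₀))) (emb-* (+ 4 / 1) (A (suc k))) ⟩
    nat 6 ⊗ (α ⊗ (α ⊗ x) ⊗ (nat 4 ⊗ a₁ ⊖ a₀))                   ≡⟨ solve 3 (λ x a₀ a₁ → con (nat 6) :* (con α :* (con α :* x) :* (con (nat 4) :* a₁ :- a₀))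
                                                                      := con (nat 4) :* con α :* (con (nat 6) :* (con α :* x :* a₁)) :- con α :* con α :* (con (nat 6) :* (x :* a₀)))
                                                                     refl x a₀ a₁ ⟩
    nat 4 ⊗ α ⊗ (nat 6 ⊗ (α ⊗ x ⊗ a₁)) ⊖ α ⊗ α ⊗ (nat 6 ⊗ (x ⊗ a₀))
                                                                ≡⟨ cong₂ (λ p q → nat 4 ⊗ α ⊗ p ⊖ α ⊗ α ⊗ q) (proj₂ ih) (proj₁ ih) ⟩
    nat 4 ⊗ α ⊗ binet (α ⊗ x) ⊖ α ⊗ α ⊗ binet x                 ≡⟨ solve 1 (λ x → let b = λ u → con c₀ :+ con c₁ :* (u :* u) in
                                                                        con (nat 4) :* con α :* b (con α :* x) :- con α :* con α :* b x := b (con α :* (con α :* x))) refl x ⟩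
    binet (α ⊗ (α ⊗ x))                                         ∎)
    where
    open ≡-Reasoning
    ih : nat 6 ⊗ (α ^ k ⊗ emb (A k)) ≡ binet (α ^ k) × nat 6 ⊗ (α ^ suc k ⊗ emb (A (suc k))) ≡ binet (α ^ suc k)
    ih = consecutive k
    x a₀ a₁ : Q3
    x = α ^ k
    a₀ = emb (A k)
    a₁ = emb (A (suc k))

A-binet-at : ∀ k k′ {u} → k ≡ k′ → α ^ k′ ≡ u → nat 6 ⊗ (u ⊗ emb (A k)) ≡ binet u
A-binet-at k _ refl refl = A-binet k

numeratorForm : Q3 → Q3 → Q3 → Q3 → Q3
numeratorForm σ X Y Z = binet (α ⊗ (X ⊗ Y)) ⊗ binet (α ⊗ Z) ⊖ nat 2 ⊗ σ ⊗ Y ⊗ (binet (α ⊗ X) ⊗ binet (α ⊗ Z))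
                        ⊕ binet (α ⊗ X) ⊗ binet (α ⊗ (Y ⊗ Z))

denominatorForm : Q3 → Q3
denominatorForm u = nat 12 ⊗ (binet (α ⊗ u) ⊖ α ⊗ binet u)

F : Q3 → Q3
F q = nat 4 ⊗ sqrt3 ⊗ (one ⊖ q)

R⁻ R⁺ : Q3 → Q3 → Q3 → Q3 → Q3
R⁻ y p q r = (one ⊖ y) ⊗ (nat 2 ⊖ p ⊕ q ⊕ r ⊗ (one ⊖ y ⊖ nat 2 ⊗ p))
R⁺ y p q r = (one ⊕ y) ⊗ (nat 2 ⊕ p ⊕ q ⊕ r ⊗ (one ⊕ y ⊕ nat 2 ⊗ p))

polynomial⁻ : ∀ X Y Z → let u = α ⊗ (X ⊗ Y ⊗ Z) in
  numeratorForm one X Y Z ⊗ F (u ⊗ u) ≡ R⁻ Y (X ⊗ Y ⊗ (α ⊗ X)) (X ⊗ (α ⊗ X)) (α ⊗ (Z ⊗ Z)) ⊗ denominatorForm u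
polynomial⁻ = solve 3 (λ X Y Z →
  let b = λ v → con c₀ :+ con c₁ :* (v :* v)
      u = con α :* (X :* Y :* Z)
      p = X :* Y :* (con α :* X) ; q = X :* (con α :* X) ; r = con α :* (Z :* Z)
  in (b (con α :* (X :* Y)) :* b (con α :* Z) :- con (nat 2) :* con one :* Y :* (b (con α :* X) :* b (con α :* Z)) :+ b (con α :* X) :* b (con α :* (Y :* Z)))
       :* (con (nat 4) :* con sqrt3 :* (con one :- u :* u))
     := (con one :- Y) :* (con (nat 2) :- p :+ q :+ r :* (con one :- Y :- con (nat 2) :* p)) :* (con (nat 12) :* (b (con α :* u) :- con α :* b u))) refl
  where open Q3-Solver

polynomial⁺ : ∀ X Y Z → let u = α ⊗ (X ⊗ Y ⊗ Z) in
  numeratorForm (emb (sign Q)) X Y Z ⊗ F (u ⊗ u) ≡ R⁺ Y (X ⊗ Y ⊗ (α ⊗ X)) (X ⊗ (α ⊗ X)) (α ⊗ (Z ⊗ Z)) ⊗ denominatorForm u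
polynomial⁺ = solve 3 (λ X Y Z →
  let b = λ v → con c₀ :+ con c₁ :* (v :* v)
      u = con α :* (X :* Y :* Z)
      p = X :* Y :* (con α :* X) ; q = X :* (con α :* X) ; r = con α :* (Z :* Z)
  in (b (con α :* (X :* Y)) :* b (con α :* Z) :- con (nat 2) :* con (emb (sign Q)) :* Y :* (b (con α :* X) :* b (con α :* Z)) :+ b (con α :* X) :* b (con α :* (Y :* Z)))
       :* (con (nat 4) :* con sqrt3 :* (con one :- u :* u))
     := (con one :+ Y) :* (con (nat 2) :+ p :+ q :+ r :* (con one :+ Y :+ con (nat 2) :* p)) :* (con (nat 12) :* (b (con α :* u) :- con α :* b u))) refl
  where open Q3-Solver

cong₄ : ∀ {C : Set} (f : C → C → C → C → C) {a a′ b b′ c c′ e e′} → a ≡ a′ → b ≡ b′ → c ≡ c′ → e ≡ e′ → f a b c e ≡ f a′ b′ c′ e′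
cong₄ f refl refl refl refl = refl

module ClosedForm (j′ d m : ℕ) where

  j i n : ℕ
  j = suc j′
  i = j + d
  n = i + m

  X Y Z u : Q3
  X = α ^ j′
  Y = α ^ d
  Z = α ^ m
  u = α ⊗ (X ⊗ Y ⊗ Z)

  α^i : α ^ i ≡ α ⊗ (X ⊗ Y)
  α^i = cong (α ⊗_) (^-+ α j′ d)

  α^n : α ^ n ≡ u
  α^n = cong (α ⊗_) (trans (^-+ α (j′ + d) m) (cong (_⊗ Z) (^-+ α j′ d)))

  α^2n : α ^ (2 * n) ≡ u ⊗ u
  α^2n = trans (cong (λ k → α ^ (n + k)) (ℕ.+-identityʳ n)) (trans (^-+ α n n) (cong₂ _⊗_ α^n α^n))

  α^[i-j] : α ^ (i ∸ j) ≡ Y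
  α^[i-j] = cong (α ^_) (ℕ.m+n∸m≡n j d)

  α^[i+j-1] : α ^ (i + j ∸ 1) ≡ X ⊗ Y ⊗ (α ⊗ X)
  α^[i+j-1] = trans (^-+ α (j′ + d) j) (cong (_⊗ (α ⊗ X)) (^-+ α j′ d))

  α^[2j-1] : α ^ (2 * j ∸ 1) ≡ X ⊗ (α ⊗ X)
  α^[2j-1] = trans (^-+ α j′ (suc (j′ + 0))) (cong (λ k → X ⊗ (α ⊗ α ^ k)) (ℕ.+-identityʳ j′))

  α^[2n-2i+1] : α ^ (2 * n ∸ 2 * i + 1) ≡ α ⊗ (Z ⊗ Z)
  α^[2n-2i+1] = trans (cong (α ^_) exponent) (cong (α ⊗_) (^-+ α m m))
    where
    exponent : 2 * n ∸ 2 * i + 1 ≡ suc (m + m)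
    exponent = begin
      2 * n ∸ 2 * i + 1              ≡⟨ cong (λ k → k ∸ 2 * i + 1) (ℕ.*-distribˡ-+ 2 i m) ⟩
      2 * i + 2 * m ∸ 2 * i + 1      ≡⟨ cong (_+ 1) (ℕ.m+n∸m≡n (2 * i) (2 * m)) ⟩
      2 * m + 1                      ≡⟨ ℕ.+-comm (2 * m) 1 ⟩
      suc (m + (m + 0))              ≡⟨ cong (λ k → suc (m + k)) (ℕ.+-identityʳ m) ⟩
      suc (m + m)                    ∎
      where open ≡-Reasoning

  [1+n]∸i : suc n ∸ i ≡ suc m
  [1+n]∸i = trans (cong (_∸ i) (sym (ℕ.+-suc i m))) (ℕ.m+n∸m≡n i (suc m))

  [1+n]∸j : suc n ∸ j ≡ suc (d + m)
  [1+n]∸j = trans (cong (λ k → suc k ∸ j) (ℕ.+-assoc j d m)) (trans (cong (_∸ j) (sym (ℕ.+-suc j (d + m)))) (ℕ.m+n∸m≡n j (suc (d + m))))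

  instance
    dA≢0 : NonZero (dA n)
    dA≢0 = dA-nonZero {n} (s≤s z≤n)

  aI aJ aM aJM aN aN₁ M D : Q3
  aI = emb (A i)
  aJ = emb (A j)
  aM = emb (A (suc n ∸ i))
  aJM = emb (A (suc n ∸ j))
  aN = emb (A n)
  aN₁ = emb (A (suc n))
  M = nat 36 ⊗ α ^ suc n
  D = emb (+ 2 / 1 *ℚ dA n)

  -- Each product of two values of A is matched with α-powers summing to n + 1 (up to the factor
  -- Y = α^(i-j) for A j A(n+1-i)), so that Binet's formula applies to both factors.
  scaledNumerator : ∀ σ → (aI ⊗ aM ⊖ nat 2 ⊗ σ ⊗ (aJ ⊗ aM) ⊕ aJ ⊗ aJM) ⊗ M ≡ numeratorForm σ X Y Z
  scaledNumerator σ = begin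
    (aI ⊗ aM ⊖ nat 2 ⊗ σ ⊗ (aJ ⊗ aM) ⊕ aJ ⊗ aJM) ⊗ (nat 36 ⊗ (α ⊗ α ^ n))
        ≡⟨ cong (λ v → (aI ⊗ aM ⊖ nat 2 ⊗ σ ⊗ (aJ ⊗ aM) ⊕ aJ ⊗ aJM) ⊗ (nat 36 ⊗ (α ⊗ v))) α^n ⟩
    (aI ⊗ aM ⊖ nat 2 ⊗ σ ⊗ (aJ ⊗ aM) ⊕ aJ ⊗ aJM) ⊗ (nat 36 ⊗ (α ⊗ u))
        ≡⟨ solve 8 (λ X Y Z σ aI aJ aM aJM →
             (aI :* aM :- con (nat 2) :* σ :* (aJ :* aM) :+ aJ :* aJM) :* (con (nat 36) :* (con α :* (con α :* (X :* Y :* Z))))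
           := con (nat 6) :* (con α :* (X :* Y) :* aI) :* (con (nat 6) :* (con α :* Z :* aM))
              :- con (nat 2) :* σ :* Y :* (con (nat 6) :* (con α :* X :* aJ) :* (con (nat 6) :* (con α :* Z :* aM)))
              :+ con (nat 6) :* (con α :* X :* aJ) :* (con (nat 6) :* (con α :* (Y :* Z) :* aJM))) refl X Y Z σ aI aJ aM aJM ⟩
    nat 6 ⊗ (α ⊗ (X ⊗ Y) ⊗ aI) ⊗ (nat 6 ⊗ (α ⊗ Z ⊗ aM))
      ⊖ nat 2 ⊗ σ ⊗ Y ⊗ (nat 6 ⊗ (α ⊗ X ⊗ aJ) ⊗ (nat 6 ⊗ (α ⊗ Z ⊗ aM)))
      ⊕ nat 6 ⊗ (α ⊗ X ⊗ aJ) ⊗ (nat 6 ⊗ (α ⊗ (Y ⊗ Z) ⊗ aJM))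
        ≡⟨ cong₄ (λ bI bJ bM bJM → bI ⊗ bM ⊖ nat 2 ⊗ σ ⊗ Y ⊗ (bJ ⊗ bM) ⊕ bJ ⊗ bJM)
                 (A-binet-at i i refl α^i) (A-binet-at j j refl refl) (A-binet-at (suc n ∸ i) (suc m) [1+n]∸i refl)
                 (A-binet-at (suc n ∸ j) (suc (d + m)) [1+n]∸j (cong (α ⊗_) (^-+ α d m))) ⟩
    numeratorForm σ X Y Z
        ∎
    where
    open ≡-Reasoning
    open Q3-Solver

  scaledDenominator : D ⊗ M ≡ denominatorForm u
  scaledDenominator = begin
    emb (+ 2 / 1 *ℚ dA n) ⊗ (nat 36 ⊗ (α ⊗ α ^ n))     ≡⟨ cong₂ (λ x v → x ⊗ (nat 36 ⊗ (α ⊗ v))) (emb-* (+ 2 / 1) (dA n)) α^n ⟩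
    nat 2 ⊗ (aN₁ ⊖ aN) ⊗ (nat 36 ⊗ (α ⊗ u))             ≡⟨ solve 3 (λ u aN aN₁ → con (nat 2) :* (aN₁ :- aN) :* (con (nat 36) :* (con α :* u))
                                                                 := con (nat 12) :* (con (nat 6) :* (con α :* u :* aN₁) :- con α :* (con (nat 6) :* (u :* aN)))) refl u aN aN₁ ⟩
    nat 12 ⊗ (nat 6 ⊗ (α ⊗ u ⊗ aN₁) ⊖ α ⊗ (nat 6 ⊗ (u ⊗ aN)))
                                                        ≡⟨ cong₂ (λ x y → nat 12 ⊗ (x ⊖ α ⊗ y)) (A-binet-at (suc n) (suc n) refl (cong (α ⊗_) α^n)) (A-binet-at n n refl α^n) ⟩
    denominatorForm u                                   ∎
    where
    open ≡-Reasoning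
    open Q3-Solver

  D⊗M-invertible : D ⊗ M ⊗ (emb (½ *ℚ 1/ dA n) ⊗ (emb (+ 1 / 36) ⊗ β ^ suc n)) ≡ one
  D⊗M-invertible = begin
    D ⊗ (nat 36 ⊗ α ^ suc n) ⊗ (emb (½ *ℚ 1/ dA n) ⊗ (emb (+ 1 / 36) ⊗ β ^ suc n))
        ≡⟨ solve 4 (λ x y a b → x :* (con (nat 36) :* a) :* (y :* (con (emb (+ 1 / 36)) :* b))
                             := x :* y :* (con (nat 36) :* con (emb (+ 1 / 36)) :* (a :* b))) refl D (emb (½ *ℚ 1/ dA n)) (α ^ suc n) (β ^ suc n) ⟩
    D ⊗ emb (½ *ℚ 1/ dA n) ⊗ (one ⊗ (α ^ suc n ⊗ β ^ suc n))
        ≡⟨ cong₂ (λ x y → x ⊗ (one ⊗ y)) (sym (emb-* (+ 2 / 1 *ℚ dA n) (½ *ℚ 1/ dA n))) (α^k⊗β^k≡1 (suc n)) ⟩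
    emb (+ 2 / 1 *ℚ dA n *ℚ (½ *ℚ 1/ dA n)) ⊗ (one ⊗ one)
        ≡⟨ cong (λ x → emb x ⊗ (one ⊗ one)) (trans 2d½e≡de (ℚ.*-inverseʳ (dA n))) ⟩
    one ∎
    where
    open ≡-Reasoning
    open Q3-Solver
    2d½e≡de : + 2 / 1 *ℚ dA n *ℚ (½ *ℚ 1/ dA n) ≡ dA n *ℚ 1/ dA n
    2d½e≡de = ℚ-Solver.solve 2 (λ x y → ℚ-Solver.con (+ 2 / 1) ℚ-Solver.:* x ℚ-Solver.:* (ℚ-Solver.con ½ ℚ-Solver.:* y) ℚ-Solver.:= x ℚ-Solver.:* y)
                refl (dA n) (1/ dA n)

  closedForm : ∀ σ R r → numeratorForm (emb σ) X Y Z ⊗ F (u ⊗ u) ≡ R ⊗ denominatorForm u →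
    (r -ℚ halfDiff i j) *ℚ (+ 2 / 1 *ℚ dA n)
      ≡ A i *ℚ A (suc n ∸ i) -ℚ + 2 / 1 *ℚ σ *ℚ (A j *ℚ A (suc n ∸ i)) +ℚ A j *ℚ A (suc n ∸ j) →
    (emb r ⊖ emb (halfDiff i j)) ⊗ F (α ^ (2 * n)) ≡ R
  closedForm σ R r polynomial resistance = ⊗-cancelʳ _ D⊗M-invertible (begin
    (emb r ⊖ emb H) ⊗ F (α ^ (2 * n)) ⊗ (D ⊗ M)
        ≡⟨ solve 4 (λ x f y z → x :* f :* (y :* z) := x :* y :* z :* f) refl (emb r ⊖ emb H) (F (α ^ (2 * n))) D M ⟩
    emb (r -ℚ H) ⊗ D ⊗ M ⊗ F (α ^ (2 * n))
        ≡⟨ cong₂ (λ x y → x ⊗ M ⊗ F y) (trans (sym (emb-* (r -ℚ H) (+ 2 / 1 *ℚ dA n))) (trans (cong emb resistance) emb-numerator)) α^2n ⟩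
    (aI ⊗ aM ⊖ nat 2 ⊗ emb σ ⊗ (aJ ⊗ aM) ⊕ aJ ⊗ aJM) ⊗ M ⊗ F (u ⊗ u)
        ≡⟨ cong (_⊗ F (u ⊗ u)) (scaledNumerator (emb σ)) ⟩
    numeratorForm (emb σ) X Y Z ⊗ F (u ⊗ u)
        ≡⟨ polynomial ⟩
    R ⊗ denominatorForm u
        ≡⟨ cong (R ⊗_) (sym scaledDenominator) ⟩
    R ⊗ (D ⊗ M) ∎)
    where
    open ≡-Reasoning
    open Q3-Solver
    H : ℚ
    H = halfDiff i j
    emb-numerator : emb (A i *ℚ A (suc n ∸ i) -ℚ + 2 / 1 *ℚ σ *ℚ (A j *ℚ A (suc n ∸ i)) +ℚ A j *ℚ A (suc n ∸ j))
                    ≡ aI ⊗ aM ⊖ nat 2 ⊗ emb σ ⊗ (aJ ⊗ aM) ⊕ aJ ⊗ aJM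
    emb-numerator = cong₂ _⊕_ (cong₂ _⊖_ (emb-* (A i) (A (suc n ∸ i)))
                                         (trans (emb-* (+ 2 / 1 *ℚ σ) _) (cong₂ _⊗_ (emb-* (+ 2 / 1) σ) (emb-* (A j) (A (suc n ∸ i))))))
                              (emb-* (A j) (A (suc n ∸ j)))

mainTheorem1 : (n i j : ℕ) → 1 ≤ j → j ≤ i → i ≤ n →
    Σ ℚ (λ r → IsEffectiveResistance n (P , i) (P , j) r
      × (emb r ⊖ emb (halfDiff i j)) ⊗ (nat 4 ⊗ sqrt3 ⊗ (one ⊖ α ^ (2 * n)))
        ≡ (one ⊖ α ^ (i ∸ j))
          ⊗ (nat 2 ⊖ α ^ (i + j ∸ 1) ⊕ α ^ (2 * j ∸ 1)
             ⊕ α ^ (2 * n ∸ 2 * i + 1) ⊗ (one ⊖ α ^ (i ∸ j) ⊖ nat 2 ⊗ α ^ (i + j ∸ 1))))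
    × Σ ℚ (λ r → IsEffectiveResistance n (Q , i) (P , j) r
      × (emb r ⊖ emb (halfDiff i j)) ⊗ (nat 4 ⊗ sqrt3 ⊗ (one ⊖ α ^ (2 * n)))
        ≡ (one ⊕ α ^ (i ∸ j))
          ⊗ (nat 2 ⊕ α ^ (i + j ∸ 1) ⊕ α ^ (2 * j ∸ 1)
             ⊕ α ^ (2 * n ∸ 2 * i + 1) ⊗ (one ⊕ α ^ (i ∸ j) ⊕ nat 2 ⊗ α ^ (i + j ∸ 1))))
mainTheorem1 _ _ (suc j′) 1≤j j≤i i≤n with ℕ.m≤n⇒∃[o]m+o≡n j≤i | ℕ.m≤n⇒∃[o]m+o≡n i≤n
... | d , refl | m , refl = closed P R⁻ (polynomial⁻ X Y Z) , closed Q R⁺ (polynomial⁺ X Y Z)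
  where
  open ClosedForm j′ d m
  closed : ∀ s (R : Q3 → Q3 → Q3 → Q3 → Q3) →
    numeratorForm (emb (sign s *ℚ sign P)) X Y Z ⊗ F (u ⊗ u) ≡ R Y (X ⊗ Y ⊗ (α ⊗ X)) (X ⊗ (α ⊗ X)) (α ⊗ (Z ⊗ Z)) ⊗ denominatorForm u →
    Σ ℚ λ r → IsEffectiveResistance n (s , i) (P , j) r
            × (emb r ⊖ emb (halfDiff i j)) ⊗ F (α ^ (2 * n)) ≡ R (α ^ (i ∸ j)) (α ^ (i + j ∸ 1)) (α ^ (2 * j ∸ 1)) (α ^ (2 * n ∸ 2 * i + 1))
  closed s R polynomial = r , isEffective ,
    trans (closedForm (sign s *ℚ sign P) (R Y (X ⊗ Y ⊗ (α ⊗ X)) (X ⊗ (α ⊗ X)) (α ⊗ (Z ⊗ Z))) r polynomial resistance)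
          (sym (cong₄ R α^[i-j] α^[i+j-1] α^[2j-1] α^[2n-2i+1]))
    where
    r : ℚ
    r = proj₁ (ladder-resistance s P 1≤j j≤i i≤n)
    isEffective : IsEffectiveResistance n (s , i) (P , j) r
    isEffective = proj₁ (proj₂ (ladder-resistance s P 1≤j j≤i i≤n))
    resistance : (r -ℚ halfDiff i j) *ℚ (+ 2 / 1 *ℚ dA n)
                   ≡ A i *ℚ A (suc n ∸ i) -ℚ + 2 / 1 *ℚ (sign s *ℚ sign P) *ℚ (A j *ℚ A (suc n ∸ i)) +ℚ A j *ℚ A (suc n ∸ j)
    resistance = proj₂ (proj₂ (ladder-resistance s P 1≤j j≤i i≤n))
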